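{- Let $p$ be an odd prime and let $k\ge 2$ be an even integer dividing $p-1$; write $p=km+1$. Suppose that $-1$ is not a $k$-th power residue modulo $p$. Let $0<\alpha_1<\cdots<\alpha_m<p$ be all the $k$-th power residues modulo $p$ in $(0,p)$ and let $$I_p(k)=\left[\frac{1}{\alpha_i+\alpha_j}\right]_{1\le i,j\le m}.$$ Then $$\det I_p(k)\equiv \frac{(-1)^{\frac{m+1}{2}}}{(2k)^m}\pmod p.$$
   Context: An integer $\alpha$ with $p\nmid\alpha$ is a $k$-th power residue modulo $p$ if $\alpha\equiv x^k\pmod p$ for some integer $x$. Here $\det I_p(k)$ is a rational number whose denominator is prime to $p$, and congruences modulo $p$ between such rational numbers are understood in the ring of rationals with denominator prime to $p$. -}

module Defs where

open import Data.Nat as ℕ using (ℕ; zero; suc)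
open import Data.Nat.Divisibility as ℕD using ()
open import Data.Integer as ℤ using (ℤ; +_)
open import Data.Integer.Divisibility as ℤD using ()
open import Data.Fin using (Fin; zero; suc; punchIn; toℕ)
open import Data.Product using (Σ; _×_)
open import Relation.Nullary using (¬_)
open import Data.Rational as ℚ using (ℚ; 0ℚ; 1ℚ)

KthPowerResidue : ℕ → ℕ → ℤ → Set
KthPowerResidue k p α =
  (¬ ((+ p) ℤD.∣ α)) × Σ ℤ (λ x → (+ p) ℤD.∣ (x ℤ.^ k ℤ.- α))

-- 1/n as a rational for n ≥ 1 (only used with n ≥ 1; value 0 at n = 0 is a dummy)
invℕ : ℕ → ℚ
invℕ zero    = 0ℚ
invℕ (suc n) = (+ 1) ℚ./ suc n

sumFin : (n : ℕ) → (Fin n → ℚ) → ℚ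
sumFin zero    f = 0ℚ
sumFin (suc n) f = f zero ℚ.+ sumFin n (λ i → f (suc i))

signℚ : ℕ → ℚ
signℚ zero    = 1ℚ
signℚ (suc i) = ℚ.- signℚ i

det : (n : ℕ) → (Fin n → Fin n → ℚ) → ℚ
det zero    M = 1ℚ
det (suc n) M =
  sumFin (suc n) (λ i → signℚ (toℕ i) ℚ.* M i zero ℚ.* det n (λ r c → M (punchIn i r) (suc c)))

-- congruence modulo p in the ring of rationals with denominator prime to p
_≡ℚ_[mod_] : ℚ → ℚ → ℕ → Set
x ≡ℚ y [mod p ] =
  (¬ (p ℕD.∣ ℚ.↧ₙ x)) × (¬ (p ℕD.∣ ℚ.↧ₙ y)) × ((+ p) ℤD.∣ ℚ.↥ (x ℚ.- y))

module Submission where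

-- Cauchy's determinant identity, proved by scaling rows and clearing the first column, gives
-- det [1/(aᵢ+aⱼ)] · ∏ᵢⱼ (aᵢ+aⱼ) = ∏_{i<j} (aⱼ-aᵢ)².  Modulo p the residues α₁,…,αₘ are exactly the
-- m-th roots of unity, since multiplication by any αⱼ permutes them; hence xᵐ - 1 ≡ ∏ⱼ (x - αⱼ).
-- As -1 is not a k-th power residue it is not a root, so m is odd.  Evaluating the factorisation
-- at 0 and at -αᵢ gives ∏ⱼ αⱼ ≡ 1 and ∏ⱼ (αᵢ+αⱼ) ≡ 2, and its derivative at αᵢ gives
-- ∏_{j≠i} (αᵢ-αⱼ) ≡ m αᵢ^(m-1).  So ∏ᵢⱼ (αᵢ+αⱼ) ≡ 2ᵐ and ∏_{i<j} (αⱼ-αᵢ)² ≡ (-1)^(m(m-1)/2) mᵐ,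
-- and km ≡ -1 turns their quotient into (-1)^((m+1)/2) / (2k)ᵐ.

open import Algebra.Bundles using (CommutativeMonoid)
open import Data.Empty using (⊥-elim)
open import Data.Fin as Fin using (Fin; zero; suc; punchIn; punchOut; toℕ)
open import Data.Fin.Properties
  using (<-cmp; punchIn-punchOut; punchOut-injective; suc-injective; punchInᵢ≢i; punchIn-injective; toℕ<n; toℕ-injective; toℕ-fromℕ<)
import Data.Integer as ℤ
open import Data.Nat as ℕ using (ℕ; zero; suc)
import Data.Nat.Properties as ℕP
open import Data.Nat.Primality using (Prime)
open import Data.Product using (Σ; _,_)
open import Data.Sum using (_⊎_; inj₁; inj₂)
open import Function using (_∘_; _$_; id)
open import Function.Definitions using (Injective)
open import Relation.Binary.Definitions using (tri<; tri≈; tri>)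
open import Relation.Binary.PropositionalEquality as ≡ using (_≡_; _≢_; cong)
open import Relation.Nullary using (¬_)
open import Defs using (KthPowerResidue)

module BigProduct {c ℓ} (M : CommutativeMonoid c ℓ) where

  open CommutativeMonoid M renaming (_∙_ to _*_; ε to 1#; ∙-congˡ to *-congˡ)
  open import Algebra.Properties.CommutativeMonoid.Sum M public
    using () renaming (sum to ∏; sum-cong-≋ to ∏-cong; ∑-distrib-+ to ∏-distrib-*; sum-remove to ∏-remove)
  open import Algebra.Solver.CommutativeMonoid M using (solve; _⊕_; _⊜_)
  open import Relation.Binary.Reasoning.Setoid setoid

  ∏-reindex : ∀ {n} (f : Fin n → Carrier) (σ : Fin n → Fin n) → Injective _≡_ _≡_ σ →
              ∏ (f ∘ σ) ≈ ∏ f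
  ∏-reindex {zero}  f σ σ-inj = refl
  ∏-reindex {suc n} f σ σ-inj = begin
    f (σ zero) * ∏ (f ∘ σ ∘ suc)
      ≈⟨ *-congˡ (∏-cong λ i → reflexive (cong f (≡.sym (punchIn-punchOut (σ₀≢ i))))) ⟩
    f (σ zero) * ∏ (f ∘ punchIn (σ zero) ∘ τ)
      ≈⟨ *-congˡ (∏-reindex (f ∘ punchIn (σ zero)) τ τ-inj) ⟩
    f (σ zero) * ∏ (f ∘ punchIn (σ zero))
      ≈⟨ sym (∏-remove f) ⟩
    ∏ f ∎
    where
    σ₀≢ : ∀ i → σ zero ≢ σ (suc i)
    σ₀≢ i eq with () ← σ-inj eq
    τ : Fin n → Fin n
    τ i = punchOut (σ₀≢ i)
    τ-inj : Injective _≡_ _≡_ τ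
    τ-inj {i} {j} eq = suc-injective (σ-inj (punchOut-injective (σ₀≢ i) (σ₀≢ j) eq))

  ∏∏-suc : ∀ {n} (f : Fin (suc n) → Fin (suc n) → Carrier) →
           ∏ (λ i → ∏ (f i)) ≈
           f zero zero * ∏ (λ r → f (suc r) zero) * ∏ (λ r → f zero (suc r))
             * ∏ (λ i → ∏ (λ j → f (suc i) (suc j)))
  ∏∏-suc {n} f = begin
    (f₀₀ * ∏ (λ r → f zero (suc r))) * ∏ (λ i → f (suc i) zero * ∏ (λ j → f (suc i) (suc j)))
      ≈⟨ *-congˡ (∏-distrib-* (λ r → f (suc r) zero) (λ i → ∏ (λ j → f (suc i) (suc j)))) ⟩
    (f₀₀ * ∏ (λ r → f zero (suc r))) * (∏ (λ r → f (suc r) zero) * ∏ (λ i → ∏ (λ j → f (suc i) (suc j))))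
      ≈⟨ solve 4 (λ a b c d → (a ⊕ b) ⊕ (c ⊕ d) ⊜ ((a ⊕ c) ⊕ b) ⊕ d) refl f₀₀ _ _ _ ⟩
    f₀₀ * ∏ (λ r → f (suc r) zero) * ∏ (λ r → f zero (suc r)) * ∏ (λ i → ∏ (λ j → f (suc i) (suc j))) ∎
    where
    f₀₀ : Carrier
    f₀₀ = f zero zero

module IntegerProduct where

  open import Data.Integer as ℤ using (ℤ; +_; 1ℤ; -1ℤ; _^_)
  import Data.Integer.Properties as ℤP
  open import Data.Integer.Tactic.RingSolver using (solve-∀)
  open ≡ using (refl; sym; trans)
  open BigProduct ℤP.*-1-commutativeMonoid public using (∏; ∏-cong; ∏-distrib-*; ∏-reindex; ∏∏-suc)

  ∏-const : ∀ n x → ∏ {n} (λ _ → x) ≡ x ^ n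
  ∏-const zero    x = refl
  ∏-const (suc n) x = cong (x ℤ.*_) (∏-const n x)

  ∏-neg : ∀ {n} (f : Fin n → ℤ) → ∏ (λ r → ℤ.- f r) ≡ -1ℤ ^ n ℤ.* ∏ f
  ∏-neg {zero}  f = refl
  ∏-neg {suc n} f = trans (cong (ℤ.- f zero ℤ.*_) (∏-neg (f ∘ suc))) (lemma (f zero) (-1ℤ ^ n) (∏ (f ∘ suc)))
    where
    lemma : ∀ x s P → ℤ.- x ℤ.* (s ℤ.* P) ≡ -1ℤ ℤ.* s ℤ.* (x ℤ.* P)
    lemma = solve-∀

  ^-distribʳ-* : ∀ x y n → (x ℤ.* y) ^ n ≡ x ^ n ℤ.* y ^ n
  ^-distribʳ-* x y zero    = refl
  ^-distribʳ-* x y (suc n) = trans (cong ((x ℤ.* y) ℤ.*_) (^-distribʳ-* x y n)) (lemma x y (x ^ n) (y ^ n))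
    where
    lemma : ∀ x y a b → x ℤ.* y ℤ.* (a ℤ.* b) ≡ x ℤ.* a ℤ.* (y ℤ.* b)
    lemma = solve-∀

  -1^even : ∀ t → -1ℤ ^ (2 ℕ.* t) ≡ 1ℤ
  -1^even t = trans (sym (ℤP.^-*-assoc -1ℤ 2 t)) (ℤP.^-zeroˡ t)

  -1^-cancel : ∀ c x → -1ℤ ^ c ℤ.* (-1ℤ ^ c ℤ.* x) ≡ x
  -1^-cancel c x = begin
    -1ℤ ^ c ℤ.* (-1ℤ ^ c ℤ.* x)   ≡⟨ sym (ℤP.*-assoc (-1ℤ ^ c) (-1ℤ ^ c) x) ⟩
    -1ℤ ^ c ℤ.* -1ℤ ^ c ℤ.* x     ≡⟨ cong (ℤ._* x) (sym (ℤP.^-distribˡ-+-* -1ℤ c c)) ⟩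
    -1ℤ ^ (c ℕ.+ c) ℤ.* x         ≡⟨ cong (λ e → -1ℤ ^ e ℤ.* x) (cong (c ℕ.+_) (sym (ℕP.+-identityʳ c))) ⟩
    -1ℤ ^ (2 ℕ.* c) ℤ.* x         ≡⟨ cong (ℤ._* x) (-1^even c) ⟩
    1ℤ ℤ.* x                      ≡⟨ ℤP.*-identityˡ x ⟩
    x                             ∎
    where
    open ≡.≡-Reasoning

  pos-^ : ∀ a n → + (a ℕ.^ n) ≡ (+ a) ^ n
  pos-^ a zero    = refl
  pos-^ a (suc n) = trans (ℤP.pos-* a (a ℕ.^ n)) (cong (+ a ℤ.*_) (pos-^ a n))

module Determinant where

  open import Defs
  open import Data.Rational as ℚ using (ℚ; 0ℚ; 1ℚ; _+_; _*_; -_; _-_)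
  import Data.Rational.Properties as ℚP
  open import Data.Rational.Solver using (module +-*-Solver)
  open +-*-Solver using (solve; _:+_; _:*_; _:-_; :-_; _:=_; con)
  open import Data.Vec.Functional using (updateAt)
  open import Data.Vec.Functional.Properties using (updateAt-updates; updateAt-minimal)
  open import Relation.Nullary using (yes; no)
  open ≡ using (refl; sym; trans; cong₂; subst)
  open ≡.≡-Reasoning
  open BigProduct ℚP.*-1-commutativeMonoid using (∏; ∏-remove)

  Matrix : ℕ → Set
  Matrix n = Fin n → Fin n → ℚ

  sgn : ∀ {n} → Fin n → ℚ
  sgn i = signℚ (toℕ i)

  minor : ∀ {n} → Fin (suc n) → Matrix (suc n) → Matrix n
  minor i M r c = M (punchIn i r) (suc c)

  laplaceTerm : ∀ {n} → Matrix (suc n) → Fin (suc n) → ℚ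
  laplaceTerm {n} M i = sgn i * M i zero * det n (minor i M)

  sumFin-cong : ∀ n {f g : Fin n → ℚ} → (∀ i → f i ≡ g i) → sumFin n f ≡ sumFin n g
  sumFin-cong zero    eq = refl
  sumFin-cong (suc n) eq = cong₂ _+_ (eq zero) (sumFin-cong n (eq ∘ suc))

  sumFin-distrib-+ : ∀ n (f g : Fin n → ℚ) → sumFin n (λ i → f i + g i) ≡ sumFin n f + sumFin n g
  sumFin-distrib-+ zero    f g = refl
  sumFin-distrib-+ (suc n) f g =
    trans (cong (f zero + g zero +_) (sumFin-distrib-+ n (f ∘ suc) (g ∘ suc)))
          (solve 4 (λ a b c d → a :+ b :+ (c :+ d) := a :+ c :+ (b :+ d)) refl (f zero) (g zero) _ _)

  sumFin-distribˡ-* : ∀ n a (f : Fin n → ℚ) → sumFin n (λ i → a * f i) ≡ a * sumFin n f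
  sumFin-distribˡ-* zero    a f = sym (ℚP.*-zeroʳ a)
  sumFin-distribˡ-* (suc n) a f =
    trans (cong (a * f zero +_) (sumFin-distribˡ-* n a (f ∘ suc))) (sym (ℚP.*-distribˡ-+ a _ _))

  sumFin-zero : ∀ n (f : Fin n → ℚ) → (∀ i → f i ≡ 0ℚ) → sumFin n f ≡ 0ℚ
  sumFin-zero zero    f eq = refl
  sumFin-zero (suc n) f eq = cong₂ _+_ (eq zero) (sumFin-zero n (f ∘ suc) (eq ∘ suc))

  sumFin-remove : ∀ n (f : Fin (suc n) → ℚ) i → sumFin (suc n) f ≡ f i + sumFin n (f ∘ punchIn i)
  sumFin-remove n       f zero    = refl
  sumFin-remove (suc n) f (suc i) =
    trans (cong (f zero +_) (sumFin-remove n (f ∘ suc) i))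
          (solve 3 (λ a b c → a :+ (b :+ c) := b :+ (a :+ c)) refl (f zero) (f (suc i)) _)

  signℚ-+ : ∀ a b → signℚ a * signℚ b ≡ signℚ (a ℕ.+ b)
  signℚ-+ zero    b = ℚP.*-identityˡ _
  signℚ-+ (suc a) b = trans (sym (ℚP.neg-distribˡ-* (signℚ a) (signℚ b))) (cong -_ (signℚ-+ a b))

  signℚ-square : ∀ a → signℚ a * signℚ a ≡ 1ℚ
  signℚ-square zero    = refl
  signℚ-square (suc a) =
    trans (solve 1 (λ x → (:- x) :* (:- x) := x :* x) refl (signℚ a)) (signℚ-square a)

  det-cong : ∀ n {M N : Matrix n} → (∀ i j → M i j ≡ N i j) → det n M ≡ det n N
  det-cong zero    eq = refl
  det-cong (suc n) eq = sumFin-cong (suc n) λ i →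
    cong₂ _*_ (cong (sgn i *_) (eq i zero)) (det-cong n λ r c → eq (punchIn i r) (suc c))

  det-scaleRows : ∀ n (a : Fin n → ℚ) (M : Matrix n) →
                  det n (λ i j → a i * M i j) ≡ ∏ a * det n M
  det-scaleRows zero    a M = refl
  det-scaleRows (suc n) a M = begin
    sumFin (suc n) (λ i → sgn i * (a i * M i zero) * det n (λ r c → a (punchIn i r) * minor i M r c))
      ≡⟨ sumFin-cong (suc n) (λ i → cong (sgn i * (a i * M i zero) *_) (det-scaleRows n (a ∘ punchIn i) (minor i M))) ⟩
    sumFin (suc n) (λ i → sgn i * (a i * M i zero) * (∏ (a ∘ punchIn i) * det n (minor i M)))
      ≡⟨ sumFin-cong (suc n) (λ i → regroup (sgn i) (a i) (M i zero) (∏ (a ∘ punchIn i)) (det n (minor i M))) ⟩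
    sumFin (suc n) (λ i → (a i * ∏ (a ∘ punchIn i)) * laplaceTerm M i)
      ≡⟨ sumFin-cong (suc n) (λ i → cong (_* laplaceTerm M i) (sym (∏-remove {i = i} a))) ⟩
    sumFin (suc n) (λ i → ∏ a * laplaceTerm M i)
      ≡⟨ sumFin-distribˡ-* (suc n) (∏ a) (laplaceTerm M) ⟩
    ∏ a * det (suc n) M ∎
    where
    regroup : ∀ s x m p d → s * (x * m) * (p * d) ≡ (x * p) * (s * m * d)
    regroup = solve 5 (λ s x m p d → s :* (x :* m) :* (p :* d) := (x :* p) :* (s :* m :* d)) refl

  det-scaleColumns : ∀ n (b : Fin n → ℚ) (M : Matrix n) →
                     det n (λ i j → M i j * b j) ≡ ∏ b * det n M
  det-scaleColumns zero    b M = refl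
  det-scaleColumns (suc n) b M = begin
    sumFin (suc n) (λ i → sgn i * (M i zero * b zero) * det n (λ r c → minor i M r c * b (suc c)))
      ≡⟨ sumFin-cong (suc n) (λ i → cong (sgn i * (M i zero * b zero) *_) (det-scaleColumns n (b ∘ suc) (minor i M))) ⟩
    sumFin (suc n) (λ i → sgn i * (M i zero * b zero) * (∏ (b ∘ suc) * det n (minor i M)))
      ≡⟨ sumFin-cong (suc n) (λ i → regroup (sgn i) (M i zero) (b zero) (∏ (b ∘ suc)) (det n (minor i M))) ⟩
    sumFin (suc n) (λ i → ∏ b * laplaceTerm M i)
      ≡⟨ sumFin-distribˡ-* (suc n) (∏ b) (laplaceTerm M) ⟩
    ∏ b * det (suc n) M ∎
    where
    regroup : ∀ s m x p d → s * (m * x) * (p * d) ≡ (x * p) * (s * m * d)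
    regroup = solve 5 (λ s m x p d → s :* (m :* x) :* (p :* d) := (x :* p) :* (s :* m :* d)) refl

  det-unitColumn : ∀ n (M : Matrix (suc n)) → M zero zero ≡ 1ℚ → (∀ r → M (suc r) zero ≡ 0ℚ) →
                   det (suc n) M ≡ det n (minor zero M)
  det-unitColumn n M M₀₀≡1 M₊₀≡0 = begin
    1ℚ * M zero zero * det n (minor zero M) + sumFin n (laplaceTerm M ∘ suc)
      ≡⟨ cong₂ _+_ (cong (λ x → 1ℚ * x * det n (minor zero M)) M₀₀≡1) (sumFin-zero n _ vanish) ⟩
    1ℚ * 1ℚ * det n (minor zero M) + 0ℚ
      ≡⟨ solve 1 (λ d → con 1ℚ :* con 1ℚ :* d :+ con 0ℚ := d) refl (det n (minor zero M)) ⟩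
    det n (minor zero M) ∎
    where
    vanish : ∀ r → laplaceTerm M (suc r) ≡ 0ℚ
    vanish r = begin
      sgn (suc r) * M (suc r) zero * det n (minor (suc r) M) ≡⟨ cong (λ x → sgn (suc r) * x * det n (minor (suc r) M)) (M₊₀≡0 r) ⟩
      sgn (suc r) * 0ℚ * det n (minor (suc r) M)             ≡⟨ solve 2 (λ s d → s :* con 0ℚ :* d := con 0ℚ) refl (sgn (suc r)) _ ⟩
      0ℚ                                                     ∎

  det-linear : ∀ n (i : Fin n) (A B C : Matrix n) (a b : ℚ) →
               (∀ r c → r ≢ i → A r c ≡ C r c) → (∀ r c → r ≢ i → B r c ≡ C r c) →
               (∀ c → C i c ≡ a * A i c + b * B i c) → det n C ≡ a * det n A + b * det n B
  det-linear (suc n) i A B C a b A≡C B≡C Cᵢ = begin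
    sumFin (suc n) (laplaceTerm C)
      ≡⟨ sumFin-cong (suc n) term-linear ⟩
    sumFin (suc n) (λ t → a * laplaceTerm A t + b * laplaceTerm B t)
      ≡⟨ sumFin-distrib-+ (suc n) (λ t → a * laplaceTerm A t) (λ t → b * laplaceTerm B t) ⟩
    sumFin (suc n) (λ t → a * laplaceTerm A t) + sumFin (suc n) (λ t → b * laplaceTerm B t)
      ≡⟨ cong₂ _+_ (sumFin-distribˡ-* (suc n) a (laplaceTerm A)) (sumFin-distribˡ-* (suc n) b (laplaceTerm B)) ⟩
    a * det (suc n) A + b * det (suc n) B ∎
    where
    term-linear : ∀ t → laplaceTerm C t ≡ a * laplaceTerm A t + b * laplaceTerm B t
    term-linear t with t Fin.≟ i
    ... | yes refl = begin
      sgn t * C t zero * det n (minor t C)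
        ≡⟨ cong (λ x → sgn t * x * det n (minor t C)) (Cᵢ zero) ⟩
      sgn t * (a * A t zero + b * B t zero) * det n (minor t C)
        ≡⟨ solve 6 (λ s a b x y d → s :* (a :* x :+ b :* y) :* d := a :* (s :* x :* d) :+ b :* (s :* y :* d)) refl
                   (sgn t) a b (A t zero) (B t zero) (det n (minor t C)) ⟩
      a * (sgn t * A t zero * det n (minor t C)) + b * (sgn t * B t zero * det n (minor t C))
        ≡⟨ cong₂ (λ x y → a * (sgn t * A t zero * x) + b * (sgn t * B t zero * y)) (sym (sameMinor A≡C)) (sym (sameMinor B≡C)) ⟩
      a * laplaceTerm A t + b * laplaceTerm B t ∎
      where
      sameMinor : ∀ {X} → (∀ r c → r ≢ t → X r c ≡ C r c) → det n (minor t X) ≡ det n (minor t C)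
      sameMinor X≡C = det-cong n λ r c → X≡C (punchIn t r) (suc c) (punchInᵢ≢i t r)
    ... | no t≢i = begin
      sgn t * C t zero * det n (minor t C)
        ≡⟨ cong (sgn t * C t zero *_) minor-linear ⟩
      sgn t * C t zero * (a * det n (minor t A) + b * det n (minor t B))
        ≡⟨ solve 6 (λ s x a b u v → s :* x :* (a :* u :+ b :* v) := a :* (s :* x :* u) :+ b :* (s :* x :* v)) refl
                   (sgn t) (C t zero) a b (det n (minor t A)) (det n (minor t B)) ⟩
      a * (sgn t * C t zero * det n (minor t A)) + b * (sgn t * C t zero * det n (minor t B))
        ≡⟨ cong₂ (λ x y → a * (sgn t * x * det n (minor t A)) + b * (sgn t * y * det n (minor t B)))
                 (sym (A≡C t zero t≢i)) (sym (B≡C t zero t≢i)) ⟩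
      a * laplaceTerm A t + b * laplaceTerm B t ∎
      where
      i′ : Fin n
      i′ = punchOut t≢i
      punchIn≢i : ∀ r → r ≢ i′ → punchIn t r ≢ i
      punchIn≢i r r≢i′ eq = r≢i′ (punchIn-injective t r i′ (trans eq (sym (punchIn-punchOut t≢i))))
      minor-linear : det n (minor t C) ≡ a * det n (minor t A) + b * det n (minor t B)
      minor-linear = det-linear n i′ (minor t A) (minor t B) (minor t C) a b
        (λ r c r≢ → A≡C (punchIn t r) (suc c) (punchIn≢i r r≢))
        (λ r c r≢ → B≡C (punchIn t r) (suc c) (punchIn≢i r r≢))
        (λ c → subst (λ z → C z (suc c) ≡ a * A z (suc c) + b * B z (suc c)) (sym (punchIn-punchOut t≢i)) (Cᵢ (suc c)))

  punchIn-punchIn : ∀ {n} (j : Fin (suc (suc n))) (r : Fin (suc n)) (r≢ : punchIn j r ≢ j) (s : Fin n) →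
                    punchIn j (punchIn r s) ≡ punchIn (punchIn j r) (punchIn (punchOut r≢) s)
  punchIn-punchIn zero    r       r≢ s       = refl
  punchIn-punchIn (suc j) zero    r≢ s       = refl
  punchIn-punchIn {suc n} (suc j) (suc r) r≢ zero    = refl
  punchIn-punchIn {suc n} (suc j) (suc r) r≢ (suc s) = cong suc (punchIn-punchIn j r (r≢ ∘ cong suc) s)

  toℕ-punchIn-punchOut : ∀ {n} (j : Fin (suc (suc n))) (r : Fin (suc n)) (r≢ : punchIn j r ≢ j) →
                         suc (toℕ r) ℕ.+ toℕ (punchOut r≢) ≡ toℕ j ℕ.+ toℕ (punchIn j r)
  toℕ-punchIn-punchOut zero    r       r≢ = ℕP.+-identityʳ _
  toℕ-punchIn-punchOut (suc j) zero    r≢ = sym (ℕP.+-identityʳ _)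
  toℕ-punchIn-punchOut {suc n} (suc j) (suc r) r≢ = begin
    suc (suc (toℕ r) ℕ.+ suc (toℕ (punchOut (r≢ ∘ cong suc))))
      ≡⟨ cong suc (ℕP.+-suc (suc (toℕ r)) _) ⟩
    suc (suc (suc (toℕ r) ℕ.+ toℕ (punchOut (r≢ ∘ cong suc))))
      ≡⟨ cong (λ x → suc (suc x)) (toℕ-punchIn-punchOut j r (r≢ ∘ cong suc)) ⟩
    suc (suc (toℕ j ℕ.+ toℕ (punchIn j r)))
      ≡⟨ cong suc (sym (ℕP.+-suc (toℕ j) _)) ⟩
    suc (toℕ j ℕ.+ suc (toℕ (punchIn j r))) ∎

  moveToFront : ∀ {n} → Fin (suc n) → Matrix (suc n) → Matrix (suc n)
  moveToFront j M zero    = M j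
  moveToFront j M (suc r) = M (punchIn j r)

  det-moveToFront : ∀ n (j : Fin (suc n)) (M : Matrix (suc n)) →
                    det (suc n) (moveToFront j M) ≡ sgn j * det (suc n) M
  det-moveToFront n zero M = trans (det-cong (suc n) unchanged) (sym (ℚP.*-identityˡ _))
    where
    unchanged : ∀ i c → moveToFront zero M i c ≡ M i c
    unchanged zero    c = refl
    unchanged (suc i) c = refl
  det-moveToFront (suc n) j@(suc _) M = begin
    laplaceTerm (moveToFront j M) zero + sumFin (suc n) (laplaceTerm (moveToFront j M) ∘ suc)
      ≡⟨ cong₂ _+_ front (sumFin-cong (suc n) rest) ⟩
    sgn j * laplaceTerm M j + sumFin (suc n) (λ r → sgn j * laplaceTerm M (punchIn j r))
      ≡⟨ cong (sgn j * laplaceTerm M j +_) (sumFin-distribˡ-* (suc n) (sgn j) (laplaceTerm M ∘ punchIn j)) ⟩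
    sgn j * laplaceTerm M j + sgn j * sumFin (suc n) (laplaceTerm M ∘ punchIn j)
      ≡⟨ sym (ℚP.*-distribˡ-+ (sgn j) _ _) ⟩
    sgn j * (laplaceTerm M j + sumFin (suc n) (laplaceTerm M ∘ punchIn j))
      ≡⟨ cong (sgn j *_) (sym (sumFin-remove (suc n) (laplaceTerm M) j)) ⟩
    sgn j * det (suc (suc n)) M ∎
    where
    front : laplaceTerm (moveToFront j M) zero ≡ sgn j * laplaceTerm M j
    front = begin
      1ℚ * M j zero * det (suc n) (minor j M)
        ≡⟨ cong (λ z → z * M j zero * det (suc n) (minor j M)) (sym (signℚ-square (toℕ j))) ⟩
      sgn j * sgn j * M j zero * det (suc n) (minor j M)
        ≡⟨ solve 3 (λ s x d → s :* s :* x :* d := s :* (s :* x :* d)) refl (sgn j) (M j zero) _ ⟩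
      sgn j * laplaceTerm M j ∎
    rest : ∀ r → laplaceTerm (moveToFront j M) (suc r) ≡ sgn j * laplaceTerm M (punchIn j r)
    rest r = begin
      sgn (suc r) * M q zero * det (suc n) (minor (suc r) (moveToFront j M))
        ≡⟨ cong (sgn (suc r) * M q zero *_) (det-cong (suc n) minor-moved) ⟩
      sgn (suc r) * M q zero * det (suc n) (moveToFront j′ (minor q M))
        ≡⟨ cong (sgn (suc r) * M q zero *_) (det-moveToFront n j′ (minor q M)) ⟩
      sgn (suc r) * M q zero * (sgn j′ * det (suc n) (minor q M))
        ≡⟨ solve 4 (λ a b x d → a :* x :* (b :* d) := (a :* b) :* (x :* d)) refl (sgn (suc r)) (sgn j′) (M q zero) _ ⟩
      (sgn (suc r) * sgn j′) * (M q zero * det (suc n) (minor q M))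
        ≡⟨ cong (_* (M q zero * det (suc n) (minor q M))) signs ⟩
      (sgn j * sgn q) * (M q zero * det (suc n) (minor q M))
        ≡⟨ solve 4 (λ a b x d → (a :* b) :* (x :* d) := a :* (b :* x :* d)) refl (sgn j) (sgn q) (M q zero) _ ⟩
      sgn j * laplaceTerm M q ∎
      where
      q : Fin (suc (suc n))
      q = punchIn j r
      q≢j : q ≢ j
      q≢j = punchInᵢ≢i j r
      j′ : Fin (suc n)
      j′ = punchOut q≢j
      minor-moved : ∀ a c → minor (suc r) (moveToFront j M) a c ≡ moveToFront j′ (minor q M) a c
      minor-moved zero    c = cong (λ z → M z (suc c)) (sym (punchIn-punchOut q≢j))
      minor-moved (suc a) c = cong (λ z → M z (suc c)) (punchIn-punchIn j r q≢j a)
      signs : sgn (suc r) * sgn j′ ≡ sgn j * sgn q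
      signs = begin
        sgn (suc r) * sgn j′                  ≡⟨ signℚ-+ (suc (toℕ r)) (toℕ j′) ⟩
        signℚ (suc (toℕ r) ℕ.+ toℕ j′)        ≡⟨ cong signℚ (toℕ-punchIn-punchOut j r q≢j) ⟩
        signℚ (toℕ j ℕ.+ toℕ q)               ≡⟨ sym (signℚ-+ (toℕ j) (toℕ q)) ⟩
        sgn j * sgn q                         ∎

  det-repeatedRow : ∀ n (j : Fin n) (M : Matrix (suc n)) → (∀ c → M zero c ≡ M (suc j) c) →
                    det (suc n) M ≡ 0ℚ
  det-repeatedRow (suc n) j M M₀≡Mⱼ = begin
    laplaceTerm M zero + sumFin (suc n) (laplaceTerm M ∘ suc)
      ≡⟨ cong (laplaceTerm M zero +_) (sumFin-remove n (laplaceTerm M ∘ suc) j) ⟩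
    laplaceTerm M zero + (laplaceTerm M (suc j) + sumFin n (laplaceTerm M ∘ suc ∘ punchIn j))
      ≡⟨ cong (λ z → laplaceTerm M zero + (laplaceTerm M (suc j) + z)) (sumFin-zero n _ others) ⟩
    1ℚ * M zero zero * D₀ + (- sgn j * M (suc j) zero * det (suc n) (minor (suc j) M) + 0ℚ)
      ≡⟨ cong₂ (λ x z → 1ℚ * M zero zero * D₀ + (- sgn j * x * z + 0ℚ)) (sym (M₀≡Mⱼ zero)) minorⱼ ⟩
    1ℚ * M zero zero * D₀ + (- sgn j * M zero zero * (sgn j * D₀) + 0ℚ)
      ≡⟨ solve 3 (λ s x d → con 1ℚ :* x :* d :+ (:- s :* x :* (s :* d) :+ con 0ℚ) := x :* d :* (con 1ℚ :- s :* s))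
                 refl (sgn j) (M zero zero) D₀ ⟩
    M zero zero * D₀ * (1ℚ - sgn j * sgn j)
      ≡⟨ cong (λ z → M zero zero * D₀ * (1ℚ - z)) (signℚ-square (toℕ j)) ⟩
    M zero zero * D₀ * (1ℚ - 1ℚ)
      ≡⟨ solve 2 (λ x d → x :* d :* (con 1ℚ :- con 1ℚ) := con 0ℚ) refl (M zero zero) D₀ ⟩
    0ℚ ∎
    where
    D₀ : ℚ
    D₀ = det (suc n) (minor zero M)
    minorⱼ : det (suc n) (minor (suc j) M) ≡ sgn j * D₀
    minorⱼ = trans (det-cong (suc n) moved) (det-moveToFront n j (minor zero M))
      where
      moved : ∀ a c → minor (suc j) M a c ≡ moveToFront j (minor zero M) a c
      moved zero    c = M₀≡Mⱼ (suc c)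
      moved (suc a) c = refl
    others : ∀ r → laplaceTerm M (suc (punchIn j r)) ≡ 0ℚ
    others r = trans (cong (sgn (suc q) * M (suc q) zero *_) (det-repeatedRow n j′ (minor (suc q) M) repeated))
                     (ℚP.*-zeroʳ (sgn (suc q) * M (suc q) zero))
      where
      q : Fin (suc n)
      q = punchIn j r
      q≢j : q ≢ j
      q≢j = punchInᵢ≢i j r
      j′ : Fin n
      j′ = punchOut q≢j
      repeated : ∀ c → minor (suc q) M zero c ≡ minor (suc q) M (suc j′) c
      repeated c = trans (M₀≡Mⱼ (suc c)) (cong (λ z → M (suc z) (suc c)) (sym (punchIn-punchOut q≢j)))

  addMultipleOfRow₀ : ∀ {n} → Fin n → ℚ → Matrix (suc n) → Matrix (suc n)
  addMultipleOfRow₀ r a M = updateAt M (suc r) (λ row c → row c + a * M zero c)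

  det-addMultipleOfRow₀ : ∀ n (r : Fin n) a (M : Matrix (suc n)) →
                          det (suc n) (addMultipleOfRow₀ r a M) ≡ det (suc n) M
  det-addMultipleOfRow₀ n r a M = begin
    det (suc n) (addMultipleOfRow₀ r a M)
      ≡⟨ det-linear (suc n) (suc r) M R₀ (addMultipleOfRow₀ r a M) 1ℚ a
                    (λ i c i≢ → sym (unchanged i c i≢)) (λ i c i≢ → trans (unchanged i c i≢) (sym (unchanged i c i≢))) rowᵣ ⟩
    1ℚ * det (suc n) M + a * det (suc n) R₀
      ≡⟨ cong (λ z → 1ℚ * det (suc n) M + a * z) (det-repeatedRow n r R₀ repeated) ⟩
    1ℚ * det (suc n) M + a * 0ℚ
      ≡⟨ solve 2 (λ d a → con 1ℚ :* d :+ a :* con 0ℚ := d) refl (det (suc n) M) a ⟩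
    det (suc n) M ∎
    where
    R₀ : Matrix (suc n)
    R₀ = updateAt M (suc r) (λ _ → M zero)
    unchanged : ∀ {f} i c → i ≢ suc r → updateAt M (suc r) f i c ≡ M i c
    unchanged i c i≢ = cong (_$ c) (updateAt-minimal i (suc r) M i≢)
    updated : ∀ {f} c → updateAt M (suc r) f (suc r) c ≡ f (M (suc r)) c
    updated c = cong (_$ c) (updateAt-updates (suc r) M)
    rowᵣ : ∀ c → addMultipleOfRow₀ r a M (suc r) c ≡ 1ℚ * M (suc r) c + a * R₀ (suc r) c
    rowᵣ c = trans (updated c) (cong₂ _+_ (sym (ℚP.*-identityˡ (M (suc r) c))) (cong (a *_) (sym (updated {λ _ → M zero} c))))
    repeated : ∀ c → R₀ zero c ≡ R₀ (suc r) c
    repeated c = trans (unchanged {λ _ → M zero} zero c λ ()) (sym (updated {λ _ → M zero} c))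

  addToRows : ∀ {n} → Matrix (suc n) → (Fin n → ℚ) → Matrix (suc n)
  addToRows M l zero    c = M zero c
  addToRows M l (suc r) c = M (suc r) c + l r * M zero c

  addToRows-split : ∀ {n} (M : Matrix (suc n)) (l : Fin n → ℚ) r₀ i c →
                    addToRows M l i c ≡ addMultipleOfRow₀ r₀ (l r₀) (addToRows M (updateAt l r₀ (λ _ → 0ℚ))) i c
  addToRows-split M l r₀ zero    c =
    sym (cong (_$ c) (updateAt-minimal zero (suc r₀) {λ row c → row c + l r₀ * M zero c} (addToRows M (updateAt l r₀ (λ _ → 0ℚ))) λ ()))
  addToRows-split M l r₀ (suc r) c with r Fin.≟ r₀
  ... | yes refl = begin
    M (suc r) c + l r * M zero c
      ≡⟨ solve 3 (λ x y a → x :+ a :* y := x :+ con 0ℚ :* y :+ a :* y) refl (M (suc r) c) (M zero c) (l r) ⟩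
    M (suc r) c + 0ℚ * M zero c + l r * M zero c
      ≡⟨ cong (λ z → M (suc r) c + z * M zero c + l r * M zero c) (sym (updateAt-updates r l)) ⟩
    addToRows M (updateAt l r (λ _ → 0ℚ)) (suc r) c + l r * M zero c
      ≡⟨ cong (_$ c) (sym (updateAt-updates (suc r) (addToRows M (updateAt l r (λ _ → 0ℚ))))) ⟩
    addMultipleOfRow₀ r (l r) (addToRows M (updateAt l r (λ _ → 0ℚ))) (suc r) c ∎
  ... | no r≢r₀ = begin
    M (suc r) c + l r * M zero c
      ≡⟨ cong (λ z → M (suc r) c + z * M zero c) (sym (updateAt-minimal r r₀ l r≢r₀)) ⟩
    addToRows M (updateAt l r₀ (λ _ → 0ℚ)) (suc r) c
      ≡⟨ cong (_$ c) (sym (updateAt-minimal (suc r) (suc r₀) (addToRows M (updateAt l r₀ (λ _ → 0ℚ))) (r≢r₀ ∘ suc-injective))) ⟩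
    addMultipleOfRow₀ r₀ (l r₀) (addToRows M (updateAt l r₀ (λ _ → 0ℚ))) (suc r) c ∎

  det-addToRows : ∀ n (M : Matrix (suc n)) (l : Fin n → ℚ) → det (suc n) (addToRows M l) ≡ det (suc n) M
  det-addToRows n M l = vanishingFrom n l λ r n≤r → ⊥-elim (ℕP.<⇒≱ (toℕ<n r) n≤r)
    where
    vanishingFrom : ∀ k l → (∀ r → k ℕ.≤ toℕ r → l r ≡ 0ℚ) → det (suc n) (addToRows M l) ≡ det (suc n) M
    vanishingFrom zero l l≡0 = det-cong (suc n) unchanged
      where
      unchanged : ∀ i c → addToRows M l i c ≡ M i c
      unchanged zero    c = refl
      unchanged (suc r) c = trans (cong (λ z → M (suc r) c + z * M zero c) (l≡0 r ℕ.z≤n))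
                                  (solve 2 (λ x y → x :+ con 0ℚ :* y := x) refl (M (suc r) c) (M zero c))
    vanishingFrom (suc k) l l≡0 with k ℕ.<? n
    ... | no k≮n = vanishingFrom k l λ r k≤r → ⊥-elim (k≮n (ℕP.≤-<-trans k≤r (toℕ<n r)))
    ... | yes k<n = begin
      det (suc n) (addToRows M l)                                  ≡⟨ det-cong (suc n) (addToRows-split M l r₀) ⟩
      det (suc n) (addMultipleOfRow₀ r₀ (l r₀) (addToRows M l′))   ≡⟨ det-addMultipleOfRow₀ n r₀ (l r₀) (addToRows M l′) ⟩
      det (suc n) (addToRows M l′)                                 ≡⟨ vanishingFrom k l′ l′≡0 ⟩
      det (suc n) M                                                ∎
      where
      r₀ : Fin n
      r₀ = Fin.fromℕ< k<n
      l′ : Fin n → ℚ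
      l′ = updateAt l r₀ (λ _ → 0ℚ)
      l′≡0 : ∀ r → k ℕ.≤ toℕ r → l′ r ≡ 0ℚ
      l′≡0 r k≤r with r Fin.≟ r₀
      ... | yes refl = updateAt-updates r₀ l
      ... | no r≢r₀  = trans (updateAt-minimal r r₀ l r≢r₀)
                             (l≡0 r (ℕP.≤∧≢⇒< k≤r λ k≡r → r≢r₀ (toℕ-injective (trans (sym k≡r) (sym (toℕ-fromℕ< k<n))))))

module IntegerEmbedding where

  open import Defs using (invℕ; signℚ)
  open import Data.Integer as ℤ using (ℤ; +_; -1ℤ)
  import Data.Integer.Properties as ℤP
  open import Data.Integer.Tactic.RingSolver using (solve-∀)
  open import Data.Rational as ℚ using (ℚ; 1ℚ; _+_; _*_; -_; _-_; ↥_; ↧_; toℚᵘ)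
  import Data.Rational.Properties as ℚP
  open import Data.Rational.Unnormalised as ℚᵘ using (mkℚᵘ; *≡*)
  import Data.Rational.Unnormalised.Properties as ℚᵘP
  open ≡ using (refl; sym; trans)
  open IntegerProduct using () renaming (∏ to ∏ℤ)
  open BigProduct ℚP.*-1-commutativeMonoid using () renaming (∏ to ∏ℚ)

  toℚ : ℤ → ℚ
  toℚ i = i ℚ./ 1

  private
    toℚᵘ-toℚ : ∀ i → toℚᵘ (toℚ i) ℚᵘ.≃ mkℚᵘ i 0
    toℚᵘ-toℚ i = ℚP.toℚᵘ-fromℚᵘ (mkℚᵘ i 0)

  toℚ-homo-* : ∀ i j → toℚ (i ℤ.* j) ≡ toℚ i * toℚ j
  toℚ-homo-* i j = ℚP.toℚᵘ-injective (ℚᵘP.≃-trans (toℚᵘ-toℚ (i ℤ.* j))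
    (ℚᵘP.≃-trans (*≡* (cross i j))
      (ℚᵘP.≃-sym (ℚᵘP.≃-trans (ℚP.toℚᵘ-homo-* (toℚ i) (toℚ j)) (ℚᵘP.*-cong (toℚᵘ-toℚ i) (toℚᵘ-toℚ j))))))
    where
    cross : ∀ i j → i ℤ.* j ℤ.* (+ 1 ℤ.* + 1) ≡ i ℤ.* j ℤ.* + 1
    cross = solve-∀

  toℚ-homo-+ : ∀ i j → toℚ (i ℤ.+ j) ≡ toℚ i + toℚ j
  toℚ-homo-+ i j = ℚP.toℚᵘ-injective (ℚᵘP.≃-trans (toℚᵘ-toℚ (i ℤ.+ j))
    (ℚᵘP.≃-trans (*≡* (cross i j))
      (ℚᵘP.≃-sym (ℚᵘP.≃-trans (ℚP.toℚᵘ-homo-+ (toℚ i) (toℚ j)) (ℚᵘP.+-cong (toℚᵘ-toℚ i) (toℚᵘ-toℚ j))))))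
    where
    cross : ∀ i j → (i ℤ.+ j) ℤ.* (+ 1 ℤ.* + 1) ≡ (i ℤ.* + 1 ℤ.+ j ℤ.* + 1) ℤ.* + 1
    cross = solve-∀

  toℚ-homo‿- : ∀ i → toℚ (ℤ.- i) ≡ - toℚ i
  toℚ-homo‿- i = ℚP.toℚᵘ-injective (ℚᵘP.≃-trans (toℚᵘ-toℚ (ℤ.- i))
    (ℚᵘP.≃-sym (ℚᵘP.≃-trans (ℚP.toℚᵘ-homo‿- (toℚ i)) (ℚᵘP.-‿cong (toℚᵘ-toℚ i)))))

  toℚ-homo-- : ∀ i j → toℚ (i ℤ.- j) ≡ toℚ i - toℚ j
  toℚ-homo-- i j = trans (toℚ-homo-+ i (ℤ.- j)) (cong (λ x → toℚ i + x) (toℚ-homo‿- j))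

  toℚ-homo-∏ : ∀ {n} (f : Fin n → ℤ) → toℚ (∏ℤ f) ≡ ∏ℚ (toℚ ∘ f)
  toℚ-homo-∏ {zero}  f = refl
  toℚ-homo-∏ {suc n} f = trans (toℚ-homo-* (f zero) _) (cong (toℚ (f zero) *_) (toℚ-homo-∏ (f ∘ suc)))

  toℚ-signℚ : ∀ n → toℚ (-1ℤ ℤ.^ n) ≡ signℚ n
  toℚ-signℚ zero    = refl
  toℚ-signℚ (suc n) = trans (cong toℚ (ℤP.-1*i≡-i (-1ℤ ℤ.^ n))) (trans (toℚ-homo‿- (-1ℤ ℤ.^ n)) (cong -_ (toℚ-signℚ n)))

  invℕ-inverseˡ : ∀ n → 0 ℕ.< n → invℕ n * toℚ (+ n) ≡ 1ℚ
  invℕ-inverseˡ (suc n) _ = ℚP.toℚᵘ-injective (ℚᵘP.≃-trans (ℚP.toℚᵘ-homo-* (invℕ (suc n)) (toℚ (+ suc n)))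
    (ℚᵘP.≃-trans (ℚᵘP.*-cong (ℚP.toℚᵘ-fromℚᵘ (mkℚᵘ (+ 1) n)) (toℚᵘ-toℚ (+ suc n))) (*≡* (cross (+ suc n)))))
    where
    cross : ∀ x → + 1 ℤ.* x ℤ.* + 1 ≡ + 1 ℤ.* (x ℤ.* + 1)
    cross = solve-∀

  signℚ*invℕ-cleared : ∀ s N → 0 ℕ.< N → signℚ s * invℕ N * toℚ (+ N) ≡ toℚ (-1ℤ ℤ.^ s)
  signℚ*invℕ-cleared s N N>0 =
    trans (ℚP.*-assoc (signℚ s) (invℕ N) (toℚ (+ N)))
          (trans (cong (signℚ s *_) (invℕ-inverseˡ N N>0)) (trans (ℚP.*-identityʳ (signℚ s)) (sym (toℚ-signℚ s))))

  *-toℚ⇒cross : ∀ q b a → q * toℚ b ≡ toℚ a → ↥ q ℤ.* b ≡ a ℤ.* ↧ q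
  *-toℚ⇒cross q@(ℚ.mkℚ _ _ _) b a eq with ℚᵘP.≃-trans (ℚᵘP.≃-sym (ℚᵘP.*-congˡ {toℚᵘ q} (toℚᵘ-toℚ b)))
                                           (ℚᵘP.≃-trans (ℚᵘP.≃-sym (ℚP.toℚᵘ-homo-* q (toℚ b)))
                                                        (ℚᵘP.≃-trans (ℚP.toℚᵘ-cong eq) (toℚᵘ-toℚ a)))
  ... | *≡* eq′ = trans (sym (ℤP.*-identityʳ _)) (trans eq′ (cong (λ d → a ℤ.* + suc d) (ℕP.*-identityʳ _)))

module Discriminant where

  open import Data.Integer as ℤ using (ℤ; +_; 1ℤ; -1ℤ; _^_)
  import Data.Integer.Properties as ℤP
  open import Data.Integer.Tactic.RingSolver using (solve-∀)
  open ≡ using (refl; sym; trans; cong₂)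
  open ≡.≡-Reasoning
  open IntegerProduct using (∏; ∏-cong; ∏-distrib-*; ∏-neg; -1^even)

  headDifferences : ∀ {n} → (Fin (suc n) → ℤ) → ℤ
  headDifferences a = ∏ λ r → a (suc r) ℤ.- a zero

  -- ∏_{i<j} (aⱼ - aᵢ)²
  discriminant : ∀ {n} → (Fin n → ℤ) → ℤ
  discriminant {zero}  a = + 1
  discriminant {suc n} a = headDifferences a ℤ.* headDifferences a ℤ.* discriminant (a ∘ suc)

  choose₂ : ℕ → ℕ
  choose₂ zero    = 0
  choose₂ (suc n) = n ℕ.+ choose₂ n

  -1^choose₂-odd : ∀ t → -1ℤ ^ choose₂ (suc (2 ℕ.* t)) ≡ -1ℤ ^ t
  -1^choose₂-odd zero    = refl
  -1^choose₂-odd (suc t) = begin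
    -1ℤ ^ choose₂ (suc (2 ℕ.* suc t))
      ≡⟨ cong (λ z → -1ℤ ^ choose₂ (suc z)) (ℕP.*-suc 2 t) ⟩
    -1ℤ ^ (suc (suc (2 ℕ.* t)) ℕ.+ (suc (2 ℕ.* t) ℕ.+ choose₂ (suc (2 ℕ.* t))))
      ≡⟨ trans (ℤP.^-distribˡ-+-* -1ℤ (suc (suc (2 ℕ.* t))) _)
               (cong (-1ℤ ^ suc (suc (2 ℕ.* t)) ℤ.*_) (ℤP.^-distribˡ-+-* -1ℤ (suc (2 ℕ.* t)) _)) ⟩
    -1ℤ ℤ.* (-1ℤ ℤ.* -1ℤ ^ (2 ℕ.* t)) ℤ.* (-1ℤ ℤ.* -1ℤ ^ (2 ℕ.* t) ℤ.* -1ℤ ^ choose₂ (suc (2 ℕ.* t)))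
      ≡⟨ cong₂ (λ e s → -1ℤ ℤ.* (-1ℤ ℤ.* e) ℤ.* (-1ℤ ℤ.* e ℤ.* s)) (-1^even t) (-1^choose₂-odd t) ⟩
    -1ℤ ℤ.* (-1ℤ ℤ.* 1ℤ) ℤ.* (-1ℤ ℤ.* 1ℤ ℤ.* -1ℤ ^ t)
      ≡⟨ lemma (-1ℤ ^ t) ⟩
    -1ℤ ^ suc t ∎
    where
    lemma : ∀ s → -1ℤ ℤ.* (-1ℤ ℤ.* 1ℤ) ℤ.* (-1ℤ ℤ.* 1ℤ ℤ.* s) ≡ -1ℤ ℤ.* s
    lemma = solve-∀

  ∏-differences : ∀ {n} (a : Fin (suc n) → ℤ) →
                  ∏ (λ i → ∏ λ r → a i ℤ.- a (punchIn i r)) ≡ -1ℤ ^ choose₂ (suc n) ℤ.* discriminant a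
  ∏-differences {zero}  a = refl
  ∏-differences {suc n} a = begin
    ∏ (λ r → a zero ℤ.- b r) ℤ.* ∏ (λ i → (b i ℤ.- a zero) ℤ.* ∏ λ r → b i ℤ.- b (punchIn i r))
      ≡⟨ cong₂ ℤ._*_ firstRow (∏-distrib-* (λ i → b i ℤ.- a zero) (λ i → ∏ λ r → b i ℤ.- b (punchIn i r))) ⟩
    -1ℤ ^ suc n ℤ.* H ℤ.* (H ℤ.* ∏ (λ i → ∏ λ r → b i ℤ.- b (punchIn i r)))
      ≡⟨ cong (λ z → -1ℤ ^ suc n ℤ.* H ℤ.* (H ℤ.* z)) (∏-differences b) ⟩
    -1ℤ ^ suc n ℤ.* H ℤ.* (H ℤ.* (-1ℤ ^ choose₂ (suc n) ℤ.* discriminant b))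
      ≡⟨ regroup (-1ℤ ^ suc n) (-1ℤ ^ choose₂ (suc n)) H (discriminant b) ⟩
    -1ℤ ^ suc n ℤ.* -1ℤ ^ choose₂ (suc n) ℤ.* discriminant a
      ≡⟨ cong (ℤ._* discriminant a) (sym (ℤP.^-distribˡ-+-* -1ℤ (suc n) (choose₂ (suc n)))) ⟩
    -1ℤ ^ choose₂ (suc (suc n)) ℤ.* discriminant a ∎
    where
    b : Fin (suc n) → ℤ
    b = a ∘ suc
    H : ℤ
    H = headDifferences a
    firstRow : ∏ (λ r → a zero ℤ.- b r) ≡ -1ℤ ^ suc n ℤ.* H
    firstRow = trans (∏-cong λ r → solve-∀′ (a zero) (b r)) (∏-neg (λ r → b r ℤ.- a zero))
      where
      solve-∀′ : ∀ x y → x ℤ.- y ≡ ℤ.- (y ℤ.- x)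
      solve-∀′ = solve-∀
    regroup : ∀ s t H D → s ℤ.* H ℤ.* (H ℤ.* (t ℤ.* D)) ≡ s ℤ.* t ℤ.* (H ℤ.* H ℤ.* D)
    regroup = solve-∀

module Cauchy where

  open import Defs
  open Determinant
  open IntegerEmbedding
  open Discriminant using (headDifferences; discriminant)
  open import Data.Integer as ℤ using (ℤ; +_)
  import Data.Integer.Properties as ℤP
  open import Data.Rational as ℚ using (ℚ; 0ℚ; 1ℚ; _+_; _*_; -_; _-_)
  import Data.Rational.Properties as ℚP
  open import Data.Rational.Solver using (module +-*-Solver)
  open +-*-Solver using (solve; _:+_; _:*_; _:-_; :-_; _:=_; con)
  open ≡ using (refl; sym; trans; cong₂)
  open ≡.≡-Reasoning
  open IntegerProduct using (∏; ∏∏-suc)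
  open BigProduct ℚP.*-1-commutativeMonoid using ()
    renaming (∏ to ∏ℚ; ∏-cong to ∏ℚ-cong; ∏-distrib-* to ∏ℚ-distrib-*)

  pairSumProduct : ∀ {n} → (Fin n → ℤ) → ℤ
  pairSumProduct a = ∏ λ i → ∏ λ j → a i ℤ.+ a j

  cauchyMatrix : ∀ {n} → (Fin n → ℕ) → Matrix n
  cauchyMatrix a i j = invℕ (a i ℕ.+ a j)

  private
    entry-after-elimination : ∀ X Y A U W → U * (X + Y) ≡ 1ℚ → W * (A + Y) ≡ 1ℚ →
      (X + A) * U + (- 1ℚ) * ((A + A) * W) ≡ (X - A) * U * ((Y - A) * W)
    entry-after-elimination X Y A U W U⁻¹ W⁻¹ = begin
      (X + A) * U + (- 1ℚ) * ((A + A) * W)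
        ≡⟨ solve 5 (λ X Y A U W → (X :+ A) :* U :+ (:- con 1ℚ) :* ((A :+ A) :* W)
                               := (X :+ A) :* U :* con 1ℚ :+ (:- con 1ℚ) :* ((A :+ A) :* W :* con 1ℚ)) refl X Y A U W ⟩
      (X + A) * U * 1ℚ + (- 1ℚ) * ((A + A) * W * 1ℚ)
        ≡⟨ cong₂ (λ s t → (X + A) * U * s + (- 1ℚ) * ((A + A) * W * t)) (sym W⁻¹) (sym U⁻¹) ⟩
      (X + A) * U * (W * (A + Y)) + (- 1ℚ) * ((A + A) * W * (U * (X + Y)))
        ≡⟨ solve 5 (λ X Y A U W → (X :+ A) :* U :* (W :* (A :+ Y)) :+ (:- con 1ℚ) :* ((A :+ A) :* W :* (U :* (X :+ Y)))
                               := (X :- A) :* U :* ((Y :- A) :* W)) refl X Y A U W ⟩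
      (X - A) * U * ((Y - A) * W) ∎

  module FirstColumnElimination {n} (a : Fin (suc n) → ℕ) (a>0 : ∀ i → 0 ℕ.< a i) where

    A : Fin (suc n) → ℤ
    A = +_ ∘ a
    x : Fin (suc n) → ℚ
    x = toℚ ∘ A
    H : ℤ
    H = headDifferences A
    M : Matrix (suc n)
    M = cauchyMatrix a
    c : Fin (suc n) → ℚ
    c i = x i + x zero
    e u w : Fin n → ℚ
    e r = x zero + x (suc r)
    u r = x (suc r) - x zero
    w r = u r * invℕ (a zero ℕ.+ a (suc r))

    toℚ-pairSum : ∀ i j → toℚ (A i ℤ.+ A j) ≡ x i + x j
    toℚ-pairSum i j = toℚ-homo-+ (A i) (A j)
    inverse : ∀ i j → invℕ (a i ℕ.+ a j) * (x i + x j) ≡ 1ℚ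
    inverse i j = trans (cong (invℕ (a i ℕ.+ a j) *_) (trans (sym (toℚ-pairSum i j)) (cong toℚ (sym (ℤP.pos-+ (a i) (a j))))))
                        (invℕ-inverseˡ (a i ℕ.+ a j) (ℕP.<-≤-trans (a>0 i) (ℕP.m≤m+n (a i) (a j))))

    M₁ M₂ : Matrix (suc n)
    M₁ i j = c i * M i j
    M₂ = addToRows M₁ (λ _ → - 1ℚ)
    diagonal : M₁ zero zero ≡ 1ℚ
    diagonal = trans (ℚP.*-comm (c zero) _) (inverse zero zero)
    firstColumn : ∀ r → M₂ (suc r) zero ≡ 0ℚ
    firstColumn r = cong₂ (λ s t → s + - 1ℚ * t) (trans (ℚP.*-comm (c (suc r)) _) (inverse (suc r) zero)) diagonal
    minorEntry : ∀ r k → minor zero M₂ r k ≡ u r * (cauchyMatrix (a ∘ suc) r k * w k)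
    minorEntry r k = trans (entry-after-elimination (x (suc r)) (x (suc k)) (x zero) _ _ (inverse (suc r) (suc k)) (inverse zero (suc k)))
                           (ℚP.*-assoc (u r) _ _)
    eliminate : ∏ℚ u * (∏ℚ w * det n (cauchyMatrix (a ∘ suc))) ≡ ∏ℚ c * det (suc n) M
    eliminate = begin
      ∏ℚ u * (∏ℚ w * det n (cauchyMatrix (a ∘ suc)))  ≡⟨ cong (∏ℚ u *_) (sym (det-scaleColumns n w (cauchyMatrix (a ∘ suc)))) ⟩
      ∏ℚ u * det n (λ r k → cauchyMatrix (a ∘ suc) r k * w k) ≡⟨ sym (det-scaleRows n u _) ⟩
      det n (λ r k → u r * (cauchyMatrix (a ∘ suc) r k * w k)) ≡⟨ sym (det-cong n minorEntry) ⟩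
      det n (minor zero M₂)                           ≡⟨ sym (det-unitColumn n M₂ diagonal firstColumn) ⟩
      det (suc n) M₂                                  ≡⟨ det-addToRows n M₁ (λ _ → - 1ℚ) ⟩
      det (suc n) M₁                                  ≡⟨ det-scaleRows (suc n) c M ⟩
      ∏ℚ c * det (suc n) M                            ∎
    w*e≡u : ∀ r → w r * e r ≡ u r
    w*e≡u r = trans (ℚP.*-assoc (u r) (invℕ (a zero ℕ.+ a (suc r))) (e r)) (trans (cong (u r *_) (inverse zero (suc r))) (ℚP.*-identityʳ (u r)))
    toℚ-headDifferences : toℚ (headDifferences A) ≡ ∏ℚ u
    toℚ-headDifferences = trans (toℚ-homo-∏ (λ r → A (suc r) ℤ.- A zero)) (∏ℚ-cong λ r → toℚ-homo-- (A (suc r)) (A zero))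
    pairSumProduct-suc : toℚ (pairSumProduct A) ≡ ∏ℚ c * ∏ℚ e * toℚ (pairSumProduct (A ∘ suc))
    pairSumProduct-suc = begin
      toℚ (pairSumProduct A)
        ≡⟨ cong toℚ (∏∏-suc (λ i j → A i ℤ.+ A j)) ⟩
      toℚ (A₀₀ ℤ.* Col ℤ.* Row ℤ.* P′)
        ≡⟨ trans (toℚ-homo-* (A₀₀ ℤ.* Col ℤ.* Row) P′)
                 (cong (_* toℚ P′) (trans (toℚ-homo-* (A₀₀ ℤ.* Col) Row) (cong (_* toℚ Row) (toℚ-homo-* A₀₀ Col)))) ⟩
      toℚ A₀₀ * toℚ Col * toℚ Row * toℚ P′
        ≡⟨ cong₂ (λ s t → s * t * toℚ P′)
                 (cong₂ _*_ (toℚ-pairSum zero zero)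
                            (trans (toℚ-homo-∏ (λ r → A (suc r) ℤ.+ A zero)) (∏ℚ-cong λ r → toℚ-pairSum (suc r) zero)))
                 (trans (toℚ-homo-∏ (λ r → A zero ℤ.+ A (suc r))) (∏ℚ-cong λ r → toℚ-pairSum zero (suc r))) ⟩
      ∏ℚ c * ∏ℚ e * toℚ P′ ∎
      where
      A₀₀ Col Row P′ : ℤ
      A₀₀ = A zero ℤ.+ A zero
      Col = ∏ λ r → A (suc r) ℤ.+ A zero
      Row = ∏ λ r → A zero ℤ.+ A (suc r)
      P′ = pairSumProduct (A ∘ suc)

  cauchy-det : ∀ n (a : Fin n → ℕ) → (∀ i → 0 ℕ.< a i) →
               det n (cauchyMatrix a) * toℚ (pairSumProduct (+_ ∘ a)) ≡ toℚ (discriminant (+_ ∘ a))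
  cauchy-det zero    a a>0 = refl
  cauchy-det (suc n) a a>0 = begin
    det (suc n) M * toℚ (pairSumProduct A)
      ≡⟨ cong (det (suc n) M *_) pairSumProduct-suc ⟩
    det (suc n) M * (∏ℚ c * ∏ℚ e * toℚ (pairSumProduct (A ∘ suc)))
      ≡⟨ solve 4 (λ d x y z → d :* (x :* y :* z) := (x :* d) :* y :* z) refl (det (suc n) M) (∏ℚ c) (∏ℚ e) _ ⟩
    ∏ℚ c * det (suc n) M * ∏ℚ e * toℚ (pairSumProduct (A ∘ suc))
      ≡⟨ cong (λ z → z * ∏ℚ e * toℚ (pairSumProduct (A ∘ suc))) (sym eliminate) ⟩
    ∏ℚ u * (∏ℚ w * det n (cauchyMatrix (a ∘ suc))) * ∏ℚ e * toℚ (pairSumProduct (A ∘ suc))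
      ≡⟨ solve 5 (λ p q d y z → p :* (q :* d) :* y :* z := p :* (q :* y) :* (d :* z)) refl
                 (∏ℚ u) (∏ℚ w) (det n (cauchyMatrix (a ∘ suc))) (∏ℚ e) _ ⟩
    ∏ℚ u * (∏ℚ w * ∏ℚ e) * (det n (cauchyMatrix (a ∘ suc)) * toℚ (pairSumProduct (A ∘ suc)))
      ≡⟨ cong₂ (λ s t → ∏ℚ u * s * t) (trans (sym (∏ℚ-distrib-* w e)) (∏ℚ-cong w*e≡u)) (cauchy-det n (a ∘ suc) (a>0 ∘ suc)) ⟩
    ∏ℚ u * ∏ℚ u * toℚ (discriminant (A ∘ suc))
      ≡⟨ cong (λ s → s * s * toℚ (discriminant (A ∘ suc))) (sym toℚ-headDifferences) ⟩
    toℚ H * toℚ H * toℚ (discriminant (A ∘ suc))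
      ≡⟨ sym (trans (toℚ-homo-* (H ℤ.* H) (discriminant (A ∘ suc))) (cong (_* toℚ (discriminant (A ∘ suc))) (toℚ-homo-* H H))) ⟩
    toℚ (discriminant A) ∎
    where
    open FirstColumnElimination a a>0

module Congruence (p : ℕ) (p-prime : Prime p) where

  open import Data.Integer as ℤ using (ℤ; +_; 0ℤ; 1ℤ; -1ℤ; _^_)
  import Data.Integer.Properties as ℤP
  open import Data.Integer.Tactic.RingSolver using (solve-∀)
  open import Data.Integer.Divisibility.Signed public using (_∣_; divides; ∣ᵤ⇒∣; ∣⇒∣ᵤ)
  open import Data.Integer.Divisibility.Signed using (∣m∣n⇒∣m+n; ∣m⇒∣-m; ∣n⇒∣m*n; ∣m⇒∣m*n)
  import Data.Nat.Divisibility as ℕ∣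
  open import Data.Nat.DivMod using (_%_; _/_; m≡m%n+[m/n]*n)
  open import Data.Nat.Primality using (euclidsLemma; prime⇒nonTrivial; prime⇒nonZero)
  open import Algebra.Bundles using (CommutativeMonoid)
  open import Relation.Binary.Bundles using (Setoid)
  open ≡ using (refl; sym; trans; subst)
  open IntegerProduct using (∏)

  P : ℤ
  P = + p

  1<p : 1 ℕ.< p
  1<p = ℕ.nonTrivial⇒n>1 p {{prime⇒nonTrivial p-prime}}

  infix 4 _≈_
  -- A record rather than a synonym, so that x and y can be inferred from x ≈ y.
  record _≈_ (x y : ℤ) : Set where
    constructor congruent
    field p∣x-y : P ∣ x ℤ.- y
  open _≈_ public

  ∣-resp-≡ : ∀ {x y} → x ≡ y → P ∣ x → P ∣ y
  ∣-resp-≡ = subst (P ∣_)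

  ≈-reflexive : ∀ {x y} → x ≡ y → x ≈ y
  ≈-reflexive {x} refl = congruent (divides 0ℤ (ℤP.+-inverseʳ x))

  ≈-refl : ∀ {x} → x ≈ x
  ≈-refl {x} = ≈-reflexive {x} refl

  ≈-sym : ∀ {x y} → x ≈ y → y ≈ x
  ≈-sym {x} {y} (congruent d) = congruent (∣-resp-≡ (lemma x y) (∣m⇒∣-m d))
    where
    lemma : ∀ x y → ℤ.- (x ℤ.- y) ≡ y ℤ.- x
    lemma = solve-∀

  ≈-trans : ∀ {x y z} → x ≈ y → y ≈ z → x ≈ z
  ≈-trans {x} {y} {z} (congruent d₁) (congruent d₂) = congruent (∣-resp-≡ (lemma x y z) (∣m∣n⇒∣m+n d₁ d₂))
    where
    lemma : ∀ x y z → (x ℤ.- y) ℤ.+ (y ℤ.- z) ≡ x ℤ.- z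
    lemma = solve-∀

  +-cong : ∀ {x y u v} → x ≈ y → u ≈ v → x ℤ.+ u ≈ y ℤ.+ v
  +-cong {x} {y} {u} {v} (congruent d₁) (congruent d₂) = congruent (∣-resp-≡ (lemma x y u v) (∣m∣n⇒∣m+n d₁ d₂))
    where
    lemma : ∀ x y u v → (x ℤ.- y) ℤ.+ (u ℤ.- v) ≡ (x ℤ.+ u) ℤ.- (y ℤ.+ v)
    lemma = solve-∀

  -‿cong : ∀ {x y} → x ≈ y → ℤ.- x ≈ ℤ.- y
  -‿cong {x} {y} (congruent d) = congruent (∣-resp-≡ (lemma x y) (∣m⇒∣-m d))
    where
    lemma : ∀ x y → ℤ.- (x ℤ.- y) ≡ ℤ.- x ℤ.- ℤ.- y
    lemma = solve-∀

  *-cong : ∀ {x y u v} → x ≈ y → u ≈ v → x ℤ.* u ≈ y ℤ.* v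
  *-cong {x} {y} {u} {v} (congruent d₁) (congruent d₂) =
    congruent (∣-resp-≡ (lemma x y u v) (∣m∣n⇒∣m+n (∣m⇒∣m*n u d₁) (∣n⇒∣m*n y d₂)))
    where
    lemma : ∀ x y u v → (x ℤ.- y) ℤ.* u ℤ.+ y ℤ.* (u ℤ.- v) ≡ x ℤ.* u ℤ.- y ℤ.* v
    lemma = solve-∀

  *-congˡ : ∀ x {y z} → y ≈ z → x ℤ.* y ≈ x ℤ.* z
  *-congˡ x = *-cong (≈-refl {x})

  ^-cong : ∀ {x y} n → x ≈ y → x ^ n ≈ y ^ n
  ^-cong zero    x≈y = ≈-refl
  ^-cong (suc n) x≈y = *-cong x≈y (^-cong n x≈y)

  setoid : Setoid _ _
  setoid = record { Carrier = ℤ ; _≈_ = _≈_ ; isEquivalence = record { refl = ≈-refl ; sym = ≈-sym ; trans = ≈-trans } }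

  *-1-commutativeMonoid : CommutativeMonoid _ _
  *-1-commutativeMonoid = record
    { Carrier = ℤ ; _≈_ = _≈_ ; _∙_ = ℤ._*_ ; ε = 1ℤ
    ; isCommutativeMonoid = record
      { isMonoid = record
        { isSemigroup = record
          { isMagma = record { isEquivalence = Setoid.isEquivalence setoid ; ∙-cong = *-cong }
          ; assoc = λ x y z → ≈-reflexive (ℤP.*-assoc x y z) }
        ; identity = (λ x → ≈-reflexive (ℤP.*-identityˡ x)) , (λ x → ≈-reflexive (ℤP.*-identityʳ x)) }
      ; comm = λ x y → ≈-reflexive (ℤP.*-comm x y) } }

  ∣-resp-≈ : ∀ {x y} → x ≈ y → P ∣ x → P ∣ y
  ∣-resp-≈ {x} {y} (congruent d) p∣x = ∣-resp-≡ (lemma x y) (∣m∣n⇒∣m+n p∣x (∣m⇒∣-m d))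
    where
    lemma : ∀ x y → x ℤ.+ ℤ.- (x ℤ.- y) ≡ y
    lemma = solve-∀

  ∣⇒≈0 : ∀ {x} → P ∣ x → x ≈ 0ℤ
  ∣⇒≈0 {x} p∣x = congruent (∣-resp-≡ (sym (ℤP.+-identityʳ x)) p∣x)

  euclid : ∀ x y → P ∣ x ℤ.* y → P ∣ x ⊎ P ∣ y
  euclid x y p∣xy with euclidsLemma ℤ.∣ x ∣ ℤ.∣ y ∣ p-prime (subst (p ℕ∣.∣_) (ℤP.abs-* x y) (∣⇒∣ᵤ p∣xy))
  ... | inj₁ p∣x = inj₁ (∣ᵤ⇒∣ p∣x)
  ... | inj₂ p∣y = inj₂ (∣ᵤ⇒∣ p∣y)

  ∤1 : ¬ P ∣ 1ℤ
  ∤1 p∣1 = ℕP.<⇒≢ 1<p (sym (ℕ∣.∣1⇒≡1 (∣⇒∣ᵤ p∣1)))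

  ∤-1 : ¬ P ∣ -1ℤ
  ∤-1 p∣-1 = ∤1 (∣m⇒∣-m p∣-1)

  -‿injective : ∀ {x y} → ℤ.- x ≈ ℤ.- y → x ≈ y
  -‿injective {x} {y} -x≈-y =
    ≈-trans (≈-reflexive (sym (ℤP.neg-involutive x))) (≈-trans (-‿cong -x≈-y) (≈-reflexive (ℤP.neg-involutive y)))

  ∣^⇒∣ : ∀ x n → P ∣ x ^ suc n → P ∣ x
  ∣^⇒∣ x zero    p∣x = ∣-resp-≡ (ℤP.*-identityʳ x) p∣x
  ∣^⇒∣ x (suc n) p∣x with euclid x (x ^ suc n) p∣x
  ... | inj₁ p∣x′ = p∣x′
  ... | inj₂ p∣xⁿ = ∣^⇒∣ x n p∣xⁿ

  instance
    p-nonZero : ℕ.NonZero p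
    p-nonZero = prime⇒nonZero p-prime

  ∤-small : ∀ {a} → 0 ℕ.< a → a ℕ.< p → ¬ P ∣ + a
  ∤-small {suc a} _ a<p p∣a = ℕ∣.>⇒∤ a<p (∣⇒∣ᵤ p∣a)

  ∤⇒>0 : ∀ {a} → ¬ P ∣ + a → 0 ℕ.< a
  ∤⇒>0 {zero}  p∤0 = ⊥-elim (p∤0 (divides 0ℤ refl))
  ∤⇒>0 {suc a} _   = ℕ.z<s

  ∣+m-+n∣≡∣m-n∣ : ∀ a b → ℤ.∣ + a ℤ.- + b ∣ ≡ ℕ.∣ a - b ∣
  ∣+m-+n∣≡∣m-n∣ a b with ℕP.≤-total a b
  ... | inj₁ a≤b = trans (≡.cong ℤ.∣_∣ (ℤP.m-n≡m⊖n a b)) (trans (ℤP.∣⊖∣-≤ a≤b) (sym (ℕP.m≤n⇒∣m-n∣≡n∸m a≤b)))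
  ... | inj₂ b≤a = trans (≡.cong ℤ.∣_∣ (ℤP.m-n≡m⊖n a b))
                         (trans (ℤP.∣m⊖n∣≡∣n⊖m∣ a b) (trans (ℤP.∣⊖∣-≤ b≤a) (sym (ℕP.m≤n⇒∣n-m∣≡n∸m b≤a))))

  ≈-small : ∀ {a b} → a ℕ.< p → b ℕ.< p → + a ≈ + b → a ≡ b
  ≈-small {a} {b} a<p b<p (congruent p∣a-b) with ℕ.∣ a - b ∣ in ∣a-b∣≡d
  ... | zero  = ℕP.∣m-n∣≡0⇒m≡n ∣a-b∣≡d
  ... | suc d = ⊥-elim (ℕ∣.>⇒∤ d<p (subst (p ℕ∣.∣_) (trans (∣+m-+n∣≡∣m-n∣ a b) ∣a-b∣≡d) (∣⇒∣ᵤ p∣a-b)))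
    where
    d<p : suc d ℕ.< p
    d<p = subst (ℕ._< p) ∣a-b∣≡d (ℕP.≤-<-trans (ℕP.∣m-n∣≤m⊔n a b) (ℕP.⊔-lub a<p b<p))

  %-≈ : ∀ a → + (a % p) ≈ + a
  %-≈ a = congruent (divides (ℤ.- + q) (trans (≡.cong (λ z → + r ℤ.- z) a≡r+qp) (lemma (+ r) (+ q) P)))
    where
    r q : ℕ
    r = a % p
    q = a / p
    a≡r+qp : + a ≡ + r ℤ.+ + q ℤ.* P
    a≡r+qp = trans (≡.cong +_ (m≡m%n+[m/n]*n a p)) (trans (ℤP.pos-+ r (q ℕ.* p)) (≡.cong (λ z → + r ℤ.+ z) (ℤP.pos-* q p)))
    lemma : ∀ r q P → r ℤ.- (r ℤ.+ q ℤ.* P) ≡ ℤ.- q ℤ.* P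
    lemma = solve-∀

  *-cancelˡ-≈ : ∀ {c x y} → ¬ P ∣ c → c ℤ.* x ≈ c ℤ.* y → x ≈ y
  *-cancelˡ-≈ {c} {x} {y} p∤c (congruent d) with euclid c (x ℤ.- y) (∣-resp-≡ (lemma c x y) d)
    where
    lemma : ∀ c x y → c ℤ.* x ℤ.- c ℤ.* y ≡ c ℤ.* (x ℤ.- y)
    lemma = solve-∀
  ... | inj₁ p∣c = ⊥-elim (p∤c p∣c)
  ... | inj₂ p∣x-y = congruent p∣x-y

  ∣∏⇒∣ : ∀ {n} (f : Fin n → ℤ) → P ∣ ∏ f → Σ (Fin n) λ i → P ∣ f i
  ∣∏⇒∣ {zero}  f p∣1 = ⊥-elim (∤1 p∣1)
  ∣∏⇒∣ {suc n} f p∣∏ with euclid (f zero) (∏ (f ∘ suc)) p∣∏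
  ... | inj₁ p∣f₀ = zero , p∣f₀
  ... | inj₂ p∣∏′ with ∣∏⇒∣ (f ∘ suc) p∣∏′
  ...   | i , p∣fᵢ = suc i , p∣fᵢ

module RootsOfUnity (p : ℕ) (p-prime : Prime p) where

  open Congruence p p-prime
  open import Data.Integer as ℤ using (ℤ; +_; 0ℤ; 1ℤ; _^_)
  import Data.Integer.Properties as ℤP
  open import Data.Integer.Tactic.RingSolver using (solve-∀)
  open import Data.Vec using (Vec; []; _∷_; replicate)
  open import Data.Integer.Divisibility.Signed using (∣m∣n⇒∣m-n)
  open ≡ using (refl; sym; trans)
  open IntegerProduct using (∏)
  open import Relation.Binary.Reasoning.Setoid setoid

  -- A monic polynomial of degree d, given by its coefficients below the leading one, constant term first.
  Monic : ℕ → Set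
  Monic = Vec ℤ

  eval : ∀ {d} → Monic d → ℤ → ℤ
  eval []       x = 1ℤ
  eval (c ∷ cs) x = c ℤ.+ x ℤ.* eval cs x

  quotientBy : ∀ {d} → ℤ → Monic (suc d) → Monic d
  quotientBy a (c ∷ [])      = []
  quotientBy a (c ∷ c′ ∷ cs) = eval (c′ ∷ cs) a ∷ quotientBy a (c′ ∷ cs)

  eval-quotientBy : ∀ {d} a x (cs : Monic (suc d)) →
                    eval cs x ≡ eval cs a ℤ.+ (x ℤ.- a) ℤ.* eval (quotientBy a cs) x
  eval-quotientBy a x (c ∷ []) = lemma c x a
    where
    lemma : ∀ c x a → c ℤ.+ x ℤ.* + 1 ≡ c ℤ.+ a ℤ.* + 1 ℤ.+ (x ℤ.- a) ℤ.* + 1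
    lemma = solve-∀
  eval-quotientBy a x (c ∷ c′ ∷ cs) =
    trans (≡.cong (λ z → c ℤ.+ x ℤ.* z) (eval-quotientBy a x (c′ ∷ cs)))
          (lemma c x a (eval (c′ ∷ cs) a) (eval (quotientBy a (c′ ∷ cs)) x))
    where
    lemma : ∀ c x a e q → c ℤ.+ x ℤ.* (e ℤ.+ (x ℤ.- a) ℤ.* q) ≡ c ℤ.+ a ℤ.* e ℤ.+ (x ℤ.- a) ℤ.* (e ℤ.+ x ℤ.* q)
    lemma = solve-∀

  monic-factorisation : ∀ {d} (cs : Monic d) (r : Fin d → ℤ) → Injective _≡_ _≈_ r →
                        (∀ i → P ∣ eval cs (r i)) → ∀ x → eval cs x ≈ ∏ (λ i → x ℤ.- r i)
  monic-factorisation []           r r-inj roots x = ≈-refl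
  monic-factorisation {suc d} cs r r-inj roots x = begin
    eval cs x
      ≡⟨ eval-quotientBy (r zero) x cs ⟩
    eval cs (r zero) ℤ.+ (x ℤ.- r zero) ℤ.* Q x
      ≈⟨ +-cong (∣⇒≈0 (roots zero)) (≈-refl {(x ℤ.- r zero) ℤ.* Q x}) ⟩
    0ℤ ℤ.+ (x ℤ.- r zero) ℤ.* Q x
      ≡⟨ ℤP.+-identityˡ _ ⟩
    (x ℤ.- r zero) ℤ.* Q x
      ≈⟨ *-cong (≈-refl {x ℤ.- r zero}) (monic-factorisation q (r ∘ suc) (suc-injective ∘ r-inj) otherRoots x) ⟩
    (x ℤ.- r zero) ℤ.* ∏ (λ i → x ℤ.- r (suc i)) ∎
    where
    q : Monic d
    q = quotientBy (r zero) cs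
    Q : ℤ → ℤ
    Q = eval q
    -- r (suc i) is a root of cs but not of x - r zero, so by Euclid it is a root of the quotient.
    otherRoots : ∀ i → P ∣ Q (r (suc i))
    otherRoots i with euclid (r (suc i) ℤ.- r zero) (Q (r (suc i))) (∣-resp-≡ factored (∣m∣n⇒∣m-n (roots (suc i)) (roots zero)))
      where
      lemma : ∀ v w → v ℤ.+ w ℤ.- v ≡ w
      lemma = solve-∀
      factored : eval cs (r (suc i)) ℤ.- eval cs (r zero) ≡ (r (suc i) ℤ.- r zero) ℤ.* Q (r (suc i))
      factored = trans (≡.cong (ℤ._- eval cs (r zero)) (eval-quotientBy (r zero) (r (suc i)) cs)) (lemma (eval cs (r zero)) _)
    ... | inj₂ p∣Q = p∣Q
    ... | inj₁ p∣diff with () ← r-inj (congruent p∣diff)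

  xⁿ⁺¹-1 : ∀ n → Monic (suc n)
  xⁿ⁺¹-1 n = ℤ.- 1ℤ ∷ replicate n 0ℤ

  eval-xⁿ⁺¹-1 : ∀ n x → eval (xⁿ⁺¹-1 n) x ≡ x ^ suc n ℤ.- 1ℤ
  eval-xⁿ⁺¹-1 n x = trans (≡.cong (λ z → ℤ.- 1ℤ ℤ.+ x ℤ.* z) (eval-zeros n)) (ℤP.+-comm (ℤ.- 1ℤ) (x ^ suc n))
    where
    eval-zeros : ∀ n → eval (replicate n 0ℤ) x ≡ x ^ n
    eval-zeros zero    = refl
    eval-zeros (suc n) = trans (ℤP.+-identityˡ _) (≡.cong (x ℤ.*_) (eval-zeros n))

  -- (xⁿ⁺¹ - aⁿ⁺¹) / (x - a) = xⁿ + a xⁿ⁻¹ + ⋯ + aⁿ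
  geometric : ∀ n → ℤ → Monic n
  geometric zero    a = []
  geometric (suc n) a = a ^ suc n ∷ geometric n a

  eval-geometric : ∀ n x a → (x ℤ.- a) ℤ.* eval (geometric n a) x ≡ x ^ suc n ℤ.- a ^ suc n
  eval-geometric zero x a = lemma x a
    where
    lemma : ∀ x a → (x ℤ.- a) ℤ.* + 1 ≡ x ℤ.* + 1 ℤ.- a ℤ.* + 1
    lemma = solve-∀
  eval-geometric (suc n) x a =
    trans (split x a (a ^ suc n) (eval (geometric n a) x))
          (trans (≡.cong (λ z → x ℤ.* z ℤ.+ (x ℤ.- a) ℤ.* a ^ suc n) (eval-geometric n x a))
                 (merge x a (x ^ suc n) (a ^ suc n)))
    where
    split : ∀ x a c g → (x ℤ.- a) ℤ.* (c ℤ.+ x ℤ.* g) ≡ x ℤ.* ((x ℤ.- a) ℤ.* g) ℤ.+ (x ℤ.- a) ℤ.* c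
    split = solve-∀
    merge : ∀ x a X A → x ℤ.* (X ℤ.- A) ℤ.+ (x ℤ.- a) ℤ.* A ≡ x ℤ.* X ℤ.- a ℤ.* A
    merge = solve-∀

  eval-geometric-diagonal : ∀ n a → eval (geometric n a) a ≡ + suc n ℤ.* a ^ n
  eval-geometric-diagonal zero    a = refl
  eval-geometric-diagonal (suc n) a =
    trans (≡.cong (λ z → a ^ suc n ℤ.+ a ℤ.* z) (eval-geometric-diagonal n a))
          (trans (lemma a (a ^ n) (+ suc n)) (≡.cong (ℤ._* a ^ suc n) (sym (ℤP.pos-+ 1 (suc n)))))
    where
    lemma : ∀ a A n → a ℤ.* A ℤ.+ a ℤ.* (n ℤ.* A) ≡ (+ 1 ℤ.+ n) ℤ.* (a ℤ.* A)
    lemma = solve-∀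

  module _ {n} (ζ : Fin (suc n) → ℤ) (ζ-inj : Injective _≡_ _≈_ ζ) (ζ-root : ∀ i → ζ i ^ suc n ≈ 1ℤ) where

    xⁿ⁺¹-1-factorisation : ∀ x → x ^ suc n ℤ.- 1ℤ ≈ ∏ (λ i → x ℤ.- ζ i)
    xⁿ⁺¹-1-factorisation x = begin
      x ^ suc n ℤ.- 1ℤ      ≡⟨ sym (eval-xⁿ⁺¹-1 n x) ⟩
      eval (xⁿ⁺¹-1 n) x     ≈⟨ monic-factorisation (xⁿ⁺¹-1 n) ζ ζ-inj root x ⟩
      ∏ (λ i → x ℤ.- ζ i)   ∎
      where
      root : ∀ i → P ∣ eval (xⁿ⁺¹-1 n) (ζ i)
      root i = ∣-resp-≡ (sym (eval-xⁿ⁺¹-1 n (ζ i))) (p∣x-y (ζ-root i))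

    ∏-differences≈derivative : ∀ i → ∏ (λ j → ζ i ℤ.- ζ (punchIn i j)) ≈ + suc n ℤ.* ζ i ^ n
    ∏-differences≈derivative i = begin
      ∏ (λ j → ζ i ℤ.- ζ (punchIn i j))
        ≈⟨ ≈-sym (monic-factorisation (geometric n (ζ i)) (ζ ∘ punchIn i) others-inj others-roots (ζ i)) ⟩
      eval (geometric n (ζ i)) (ζ i)
        ≡⟨ eval-geometric-diagonal n (ζ i) ⟩
      + suc n ℤ.* ζ i ^ n ∎
      where
      G : ℤ → ℤ
      G = eval (geometric n (ζ i))
      others-inj : Injective _≡_ _≈_ (ζ ∘ punchIn i)
      others-inj = punchIn-injective i _ _ ∘ ζ-inj
      others-roots : ∀ j → P ∣ G (ζ (punchIn i j))
      others-roots j with euclid _ _ (∣-resp-≡ (sym (eval-geometric n (ζ (punchIn i j)) (ζ i)))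
                                               (p∣x-y (≈-trans (ζ-root (punchIn i j)) (≈-sym (ζ-root i)))))
      ... | inj₂ p∣G = p∣G
      ... | inj₁ p∣diff with () ← punchInᵢ≢i i j (ζ-inj (congruent p∣diff))

even⊎odd : ∀ n → Σ ℕ λ t → n ≡ 2 ℕ.* t ⊎ n ≡ suc (2 ℕ.* t)
even⊎odd zero    = 0 , inj₁ ≡.refl
even⊎odd (suc n) with even⊎odd n
... | t , inj₁ n≡2t   = t , inj₂ (cong suc n≡2t)
... | t , inj₂ n≡2t+1 = suc t , inj₁ (≡.trans (cong suc n≡2t+1) (≡.sym (ℕP.*-suc 2 t)))

module PowerResidues
  (p k n : ℕ) (p-prime : Prime p) (p≢2 : p ≢ 2) (k>0 : 0 ℕ.< k) (p≡km+1 : p ≡ k ℕ.* suc n ℕ.+ 1)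
  (-1-nonresidue : ¬ KthPowerResidue k p ℤ.-1ℤ)
  (α : Fin (suc n) → ℕ) (α<p : ∀ i → α i ℕ.< p) (α-injective : Injective _≡_ _≡_ α)
  (α-residue : ∀ i → KthPowerResidue k p (ℤ.+ α i))
  (α-complete : ∀ a → 0 ℕ.< a → a ℕ.< p → KthPowerResidue k p (ℤ.+ a) → Σ (Fin (suc n)) λ i → α i ≡ a)
  where

  open import Data.Integer as ℤ using (ℤ; +_; 0ℤ; 1ℤ; -1ℤ; _^_)

  open Congruence p p-prime
  open RootsOfUnity p p-prime
  open IntegerProduct using (∏; ∏-cong; ∏-const; ∏-neg; ∏-distrib-*; ∏-reindex; ^-distribʳ-*; -1^even; -1^-cancel; pos-^)
  open Discriminant using (discriminant; choose₂; ∏-differences; -1^choose₂-odd)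
  open Cauchy using (pairSumProduct)
  -- The product of this monoid is definitionally the integer product ∏.
  open BigProduct *-1-commutativeMonoid using () renaming (∏-cong to ∏-cong-≈)
  import Data.Integer.Properties as ℤP
  open import Data.Integer.Tactic.RingSolver using (solve-∀)
  open import Data.Nat.DivMod using (_%_; m%n<n; m*n/n≡m)
  open import Data.Nat.Tactic.RingSolver using () renaming (solve-∀ to ℕ-solve-∀)
  open import Data.Product using (proj₁; proj₂)
  open import Data.Sum using ([_,_]; [_,_]′)
  open ≡ using (refl; sym; trans; subst)
  open import Relation.Binary.Reasoning.Setoid setoid

  m : ℕ
  m = suc n

  A : Fin m → ℤ
  A = +_ ∘ α

  A-injective : Injective _≡_ _≈_ A
  A-injective {i} {j} Aᵢ≈Aⱼ = α-injective (≈-small (α<p i) (α<p j) Aᵢ≈Aⱼ)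

  p∤A : ∀ i → ¬ P ∣ A i
  p∤A i p∣A = proj₁ (α-residue i) (∣⇒∣ᵤ p∣A)

  p∤∏A : ¬ P ∣ ∏ A
  p∤∏A p∣∏ = let i , p∣Aᵢ = ∣∏⇒∣ A p∣∏ in p∤A i p∣Aᵢ

  kthRoot : ∀ i → Σ ℤ λ x → x ^ k ≈ A i
  kthRoot i = let x , p∣xᵏ-A = proj₂ (α-residue i) in x , congruent (∣ᵤ⇒∣ p∣xᵏ-A)

  product-residue : ∀ j i → Σ (Fin m) λ l → A l ≈ A j ℤ.* A i
  product-residue j i = proj₁ found , ≈-trans (≈-reflexive (≡.cong +_ (proj₂ found))) c≈
    where
    c : ℕ
    c = (α j ℕ.* α i) % p
    c≈ : + c ≈ A j ℤ.* A i
    c≈ = ≈-trans (%-≈ (α j ℕ.* α i)) (≈-reflexive (ℤP.pos-* (α j) (α i)))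
    p∤c : ¬ P ∣ + c
    p∤c p∣c = [ p∤A j , p∤A i ] (euclid (A j) (A i) (∣-resp-≈ c≈ p∣c))
    c-residue : KthPowerResidue k p (+ c)
    c-residue = (λ p∣c → p∤c (∣ᵤ⇒∣ p∣c)) , x ℤ.* y , ∣⇒∣ᵤ (p∣x-y xyᵏ≈c)
      where
      x y : ℤ
      x = proj₁ (kthRoot j)
      y = proj₁ (kthRoot i)
      xyᵏ≈c : (x ℤ.* y) ^ k ≈ + c
      xyᵏ≈c = ≈-trans (≈-reflexive (^-distribʳ-* x y k)) (≈-trans (*-cong (proj₂ (kthRoot j)) (proj₂ (kthRoot i))) (≈-sym c≈))
    found : Σ (Fin m) λ l → α l ≡ c
    found = α-complete c (∤⇒>0 p∤c) (m%n<n (α j ℕ.* α i) p) c-residue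

  -- Multiplication by A j permutes the residues, so A j ^ m * ∏ A ≈ ∏ A.
  A-root : ∀ j → A j ^ m ≈ 1ℤ
  A-root j = *-cancelˡ-≈ p∤∏A (begin
    ∏ A ℤ.* A j ^ m              ≡⟨ ℤP.*-comm (∏ A) (A j ^ m) ⟩
    A j ^ m ℤ.* ∏ A              ≡⟨ ≡.cong (ℤ._* ∏ A) (sym (∏-const m (A j))) ⟩
    ∏ {m} (λ _ → A j) ℤ.* ∏ A    ≡⟨ sym (∏-distrib-* (λ _ → A j) A) ⟩
    ∏ (λ i → A j ℤ.* A i)        ≈⟨ ∏-cong-≈ (λ i → ≈-sym (proj₂ (product-residue j i))) ⟩
    ∏ (A ∘ σ)                    ≡⟨ ∏-reindex A σ σ-injective ⟩
    ∏ A                          ≡⟨ sym (ℤP.*-identityʳ (∏ A)) ⟩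
    ∏ A ℤ.* 1ℤ                   ∎)
    where
    σ : Fin m → Fin m
    σ i = proj₁ (product-residue j i)
    σ-injective : Injective _≡_ _≡_ σ
    σ-injective {x} {y} σx≡σy = A-injective (*-cancelˡ-≈ (p∤A j)
      (≈-trans (≈-sym (proj₂ (product-residue j x))) (≈-trans (≈-reflexive (≡.cong A σx≡σy)) (proj₂ (product-residue j y)))))

  xᵐ-1-factorisation : ∀ x → x ^ m ℤ.- 1ℤ ≈ ∏ (λ j → x ℤ.- A j)
  xᵐ-1-factorisation = xⁿ⁺¹-1-factorisation A A-injective A-root

  m-odd : ∀ t → n ≢ suc (2 ℕ.* t)
  m-odd t n≡2t+1 = -1-nonresidue ((λ p∣-1 → ∤-1 (∣ᵤ⇒∣ p∣-1)) , x , ∣⇒∣ᵤ (p∣x-y xᵏ≈-1))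
    where
    -1ᵐ≡1 : -1ℤ ^ m ≡ 1ℤ
    -1ᵐ≡1 = trans (≡.cong (-1ℤ ^_) (trans (≡.cong suc n≡2t+1) (sym (ℕP.*-suc 2 t)))) (-1^even (suc t))
    -1-root : P ∣ ∏ (λ j → -1ℤ ℤ.- A j)
    -1-root = ∣-resp-≈ (xᵐ-1-factorisation -1ℤ) (∣-resp-≡ (≡.cong (ℤ._- 1ℤ) (sym -1ᵐ≡1)) (divides 0ℤ refl))
    j : Fin m
    j = proj₁ (∣∏⇒∣ (λ j → -1ℤ ℤ.- A j) -1-root)
    x : ℤ
    x = proj₁ (kthRoot j)
    xᵏ≈-1 : x ^ k ≈ -1ℤ
    xᵏ≈-1 = ≈-trans (proj₂ (kthRoot j)) (≈-sym (congruent (proj₂ (∣∏⇒∣ (λ j → -1ℤ ℤ.- A j) -1-root))))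

  n-even : Σ ℕ λ t → n ≡ 2 ℕ.* t
  n-even = let t , parity = even⊎odd n in t , [ id , ⊥-elim ∘ m-odd t ]′ parity

  t : ℕ
  t = proj₁ n-even

  -1^m : -1ℤ ^ m ≡ -1ℤ
  -1^m = ≡.cong (-1ℤ ℤ.*_) (trans (≡.cong (-1ℤ ^_) (proj₂ n-even)) (-1^even t))

  neg-^m : ∀ x → (ℤ.- x) ^ m ≡ ℤ.- (x ^ m)
  neg-^m x = trans (≡.cong (_^ m) (sym (ℤP.-1*i≡-i x)))
             (trans (^-distribʳ-* -1ℤ x m) (trans (≡.cong (ℤ._* x ^ m) -1^m) (ℤP.-1*i≡-i (x ^ m))))

  ∏-negᵐ : ∀ (f : Fin m → ℤ) → ∏ (λ j → ℤ.- f j) ≡ ℤ.- ∏ f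
  ∏-negᵐ f = trans (∏-neg f) (trans (≡.cong (ℤ._* ∏ f) -1^m) (ℤP.-1*i≡-i (∏ f)))

  ∏A≈1 : ∏ A ≈ 1ℤ
  ∏A≈1 = -‿injective (begin
    ℤ.- ∏ A                      ≡⟨ sym (∏-negᵐ A) ⟩
    ∏ (λ j → ℤ.- A j)            ≡⟨ ∏-cong (λ j → sym (ℤP.+-identityˡ (ℤ.- A j))) ⟩
    ∏ (λ j → 0ℤ ℤ.- A j)         ≈⟨ ≈-sym (xᵐ-1-factorisation 0ℤ) ⟩
    0ℤ ^ m ℤ.- 1ℤ                ≡⟨ ≡.cong (ℤ._- 1ℤ) (ℤP.*-zeroˡ (0ℤ ^ n)) ⟩
    ℤ.- 1ℤ                       ∎)

  ∏-pairSums≈2 : ∀ i → ∏ (λ j → A i ℤ.+ A j) ≈ + 2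
  ∏-pairSums≈2 i = -‿injective (begin
    ℤ.- ∏ (λ j → A i ℤ.+ A j)    ≡⟨ sym (∏-negᵐ (λ j → A i ℤ.+ A j)) ⟩
    ∏ (λ j → ℤ.- (A i ℤ.+ A j))  ≡⟨ ∏-cong (λ j → ℤP.neg-distrib-+ (A i) (A j)) ⟩
    ∏ (λ j → ℤ.- A i ℤ.- A j)    ≈⟨ ≈-sym (xᵐ-1-factorisation (ℤ.- A i)) ⟩
    (ℤ.- A i) ^ m ℤ.- 1ℤ         ≡⟨ ≡.cong (ℤ._- 1ℤ) (neg-^m (A i)) ⟩
    ℤ.- (A i ^ m) ℤ.- 1ℤ         ≈⟨ +-cong (-‿cong (A-root i)) (≈-refl {ℤ.- 1ℤ}) ⟩
    ℤ.- + 2                      ∎)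

  pairSumProduct≈2ᵐ : pairSumProduct A ≈ (+ 2) ^ m
  pairSumProduct≈2ᵐ = ≈-trans (∏-cong-≈ ∏-pairSums≈2) (≈-reflexive (∏-const m (+ 2)))

  ∏-derivatives≈mᵐ : ∏ (λ i → ∏ λ r → A i ℤ.- A (punchIn i r)) ≈ (+ m) ^ m
  ∏-derivatives≈mᵐ = begin
    ∏ (λ i → ∏ λ r → A i ℤ.- A (punchIn i r))    ≈⟨ ∏-cong-≈ (∏-differences≈derivative A A-injective A-root) ⟩
    ∏ (λ i → + m ℤ.* A i ^ n)                    ≡⟨ sym (ℤP.*-identityʳ _) ⟩
    ∏ (λ i → + m ℤ.* A i ^ n) ℤ.* 1ℤ             ≈⟨ *-congˡ (∏ (λ i → + m ℤ.* A i ^ n)) (≈-sym ∏A≈1) ⟩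
    ∏ (λ i → + m ℤ.* A i ^ n) ℤ.* ∏ A            ≡⟨ sym (∏-distrib-* (λ i → + m ℤ.* A i ^ n) A) ⟩
    ∏ (λ i → + m ℤ.* A i ^ n ℤ.* A i)            ≡⟨ ∏-cong (λ i → lemma (+ m) (A i) (A i ^ n)) ⟩
    ∏ (λ i → + m ℤ.* A i ^ m)                    ≈⟨ ∏-cong-≈ (λ i → *-congˡ (+ m) (A-root i)) ⟩
    ∏ {m} (λ _ → + m ℤ.* 1ℤ)                     ≡⟨ ∏-const m (+ m ℤ.* 1ℤ) ⟩
    (+ m ℤ.* 1ℤ) ^ m                             ≡⟨ ≡.cong (_^ m) (ℤP.*-identityʳ (+ m)) ⟩
    (+ m) ^ m                                    ∎
    where
    lemma : ∀ c a aⁿ → c ℤ.* aⁿ ℤ.* a ≡ c ℤ.* (a ℤ.* aⁿ)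
    lemma = solve-∀

  discriminant≈ : discriminant A ≈ -1ℤ ^ choose₂ m ℤ.* (+ m) ^ m
  discriminant≈ = begin
    discriminant A                                    ≡⟨ sym (-1^-cancel (choose₂ m) (discriminant A)) ⟩
    s ℤ.* (s ℤ.* discriminant A)                      ≡⟨ ≡.cong (s ℤ.*_) (sym (∏-differences A)) ⟩
    s ℤ.* ∏ (λ i → ∏ λ r → A i ℤ.- A (punchIn i r))   ≈⟨ *-congˡ s ∏-derivatives≈mᵐ ⟩
    s ℤ.* (+ m) ^ m                                   ∎
    where
    s : ℤ
    s = -1ℤ ^ choose₂ m

  k<p : k ℕ.< p
  k<p = subst (k ℕ.<_) (sym (trans p≡km+1 (ℕP.+-comm (k ℕ.* m) 1))) (ℕ.s≤s (ℕP.m≤m*n k m))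

  p∤2 : ¬ P ∣ + 2
  p∤2 = ∤-small (ℕ.s≤s ℕ.z≤n) (ℕP.≤∧≢⇒< 1<p (p≢2 ∘ sym))

  p∤pairSumProduct : ¬ P ∣ pairSumProduct A
  p∤pairSumProduct p∣D = p∤2 (∣^⇒∣ (+ 2) n (∣-resp-≈ pairSumProduct≈2ᵐ p∣D))

  [2k]ᵐ≡ : + ((2 ℕ.* k) ℕ.^ m) ≡ (+ 2 ℤ.* + k) ^ m
  [2k]ᵐ≡ = trans (pos-^ (2 ℕ.* k) m) (≡.cong (_^ m) (ℤP.pos-* 2 k))

  p∤[2k]ᵐ : ¬ P ∣ + ((2 ℕ.* k) ℕ.^ m)
  p∤[2k]ᵐ p∣[2k]ᵐ = [ p∤2 , ∤-small k>0 k<p ] (euclid (+ 2) (+ k) (∣^⇒∣ (+ 2 ℤ.* + k) n (∣-resp-≡ [2k]ᵐ≡ p∣[2k]ᵐ)))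

  [m+1]/2≡1+t : (m ℕ.+ 1) ℕ./ 2 ≡ suc t
  [m+1]/2≡1+t = trans (≡.cong (λ z → (suc z ℕ.+ 1) ℕ./ 2) (proj₂ n-even)) (trans (≡.cong (ℕ._/ 2) (shift t)) (m*n/n≡m (suc t) 2))
    where
    shift : ∀ t → suc (2 ℕ.* t) ℕ.+ 1 ≡ suc t ℕ.* 2
    shift = ℕ-solve-∀

  km≈-1 : + k ℤ.* + m ≈ -1ℤ
  km≈-1 = congruent (divides 1ℤ km+1≡p)
    where
    km+1≡p : + k ℤ.* + m ℤ.- -1ℤ ≡ 1ℤ ℤ.* P
    km+1≡p = trans (≡.cong (λ z → z ℤ.+ 1ℤ) (sym (ℤP.pos-* k m)))
                    (trans (sym (ℤP.pos-+ (k ℕ.* m) 1)) (trans (≡.cong +_ (sym p≡km+1)) (sym (ℤP.*-identityˡ P))))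

  discriminant-congruence : discriminant A ℤ.* + ((2 ℕ.* k) ℕ.^ m) ≈ -1ℤ ^ ((m ℕ.+ 1) ℕ./ 2) ℤ.* pairSumProduct A
  discriminant-congruence = begin
    discriminant A ℤ.* + ((2 ℕ.* k) ℕ.^ m)          ≡⟨ ≡.cong (discriminant A ℤ.*_) [2k]ᵐ≡ ⟩
    discriminant A ℤ.* (+ 2 ℤ.* + k) ^ m            ≈⟨ *-cong discriminant≈ (≈-refl {(+ 2 ℤ.* + k) ^ m}) ⟩
    s ℤ.* (+ m) ^ m ℤ.* (+ 2 ℤ.* + k) ^ m           ≡⟨ ≡.cong (s ℤ.* (+ m) ^ m ℤ.*_) (^-distribʳ-* (+ 2) (+ k) m) ⟩
    s ℤ.* (+ m) ^ m ℤ.* ((+ 2) ^ m ℤ.* (+ k) ^ m)   ≡⟨ regroup s ((+ m) ^ m) ((+ 2) ^ m) ((+ k) ^ m) ⟩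
    s ℤ.* (+ 2) ^ m ℤ.* ((+ k) ^ m ℤ.* (+ m) ^ m)   ≡⟨ ≡.cong (s ℤ.* (+ 2) ^ m ℤ.*_) (sym (^-distribʳ-* (+ k) (+ m) m)) ⟩
    s ℤ.* (+ 2) ^ m ℤ.* (+ k ℤ.* + m) ^ m           ≈⟨ *-congˡ (s ℤ.* (+ 2) ^ m) (^-cong m km≈-1) ⟩
    s ℤ.* (+ 2) ^ m ℤ.* -1ℤ ^ m                     ≡⟨ ≡.cong₂ (λ u v → u ℤ.* (+ 2) ^ m ℤ.* v) s≡ -1^m ⟩
    -1ℤ ^ t ℤ.* (+ 2) ^ m ℤ.* -1ℤ                   ≡⟨ lemma (-1ℤ ^ t) ((+ 2) ^ m) ⟩
    -1ℤ ^ suc t ℤ.* (+ 2) ^ m                       ≈⟨ *-congˡ (-1ℤ ^ suc t) (≈-sym pairSumProduct≈2ᵐ) ⟩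
    -1ℤ ^ suc t ℤ.* pairSumProduct A                ≡⟨ ≡.cong (λ e → -1ℤ ^ e ℤ.* pairSumProduct A) (sym [m+1]/2≡1+t) ⟩
    -1ℤ ^ ((m ℕ.+ 1) ℕ./ 2) ℤ.* pairSumProduct A    ∎
    where
    s : ℤ
    s = -1ℤ ^ choose₂ m
    s≡ : s ≡ -1ℤ ^ t
    s≡ = trans (≡.cong (λ z → -1ℤ ^ choose₂ (suc z)) (proj₂ n-even)) (-1^choose₂-odd t)
    regroup : ∀ s M T K → s ℤ.* M ℤ.* (T ℤ.* K) ≡ s ℤ.* T ℤ.* (K ℤ.* M)
    regroup = solve-∀
    lemma : ∀ s T → s ℤ.* T ℤ.* -1ℤ ≡ -1ℤ ℤ.* s ℤ.* T
    lemma = solve-∀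

module RationalCongruence (p : ℕ) (p-prime : Prime p) where

  open Congruence p p-prime
  open IntegerEmbedding
  open import Defs using (_≡ℚ_[mod_])
  open import Data.Integer as ℤ using (ℤ; +_)
  open import Data.Rational as ℚ using (ℚ; _*_; _-_; ↥_; ↧_; ↧ₙ_)
  open import Data.Rational.Solver using (module +-*-Solver)
  open +-*-Solver using (solve; _:*_; _:-_; _:=_)
  import Data.Integer.Properties as ℤP
  import Data.Nat.Divisibility as ℕ∣
  import Data.Nat.Coprimality as Coprimality
  open import Data.Integer.Divisibility.Signed using (∣m⇒∣m*n; ∣n⇒∣m*n)
  open import Data.Product using (_×_; proj₁; proj₂)
  open import Data.Sum using ([_,_])
  open ≡ using (refl; sym; trans; cong₂)
  open ≡.≡-Reasoning

  coprime : ∀ q → Coprimality.Coprime ℤ.∣ ↥ q ∣ (↧ₙ q)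
  coprime (ℚ.mkℚ _ _ c) = Coprimality.recompute c

  p-integral : ∀ q b a → q * toℚ b ≡ toℚ a → ¬ P ∣ b → ¬ p ℕ∣.∣ ↧ₙ q × (P ∣ a → P ∣ ↥ q)
  p-integral q b a qb≡a p∤b = p∤↧q , p∣↥q
    where
    cross : ↥ q ℤ.* b ≡ a ℤ.* ↧ q
    cross = *-toℚ⇒cross q b a qb≡a
    cancel-b : P ∣ ↥ q ℤ.* b → P ∣ ↥ q
    cancel-b p∣qb = [ id , ⊥-elim ∘ p∤b ] (euclid (↥ q) b p∣qb)
    p∣↥q : P ∣ a → P ∣ ↥ q
    p∣↥q p∣a = cancel-b (∣-resp-≡ (sym cross) (∣m⇒∣m*n (↧ q) p∣a))
    p∤↧q : ¬ p ℕ∣.∣ ↧ₙ q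
    p∤↧q p∣↧q = ℕP.<⇒≢ 1<p (sym (coprime q (∣⇒∣ᵤ p∣↥q′ , p∣↧q)))
      where
      p∣↥q′ : P ∣ ↥ q
      p∣↥q′ = cancel-b (∣-resp-≡ (sym cross) (∣n⇒∣m*n a (∣ᵤ⇒∣ {i = ↧ q} p∣↧q)))

  ≡ℚ[mod]-intro : ∀ x y a b c d → x * toℚ b ≡ toℚ a → y * toℚ d ≡ toℚ c → ¬ P ∣ b → ¬ P ∣ d →
                  P ∣ a ℤ.* d ℤ.- c ℤ.* b → x ≡ℚ y [mod p ]
  ≡ℚ[mod]-intro x y a b c d xb≡a yd≡c p∤b p∤d p∣ad-cb =
    proj₁ (p-integral x b a xb≡a p∤b) , proj₁ (p-integral y d c yd≡c p∤d) ,
    ∣⇒∣ᵤ (proj₂ (p-integral (x - y) (b ℤ.* d) (a ℤ.* d ℤ.- c ℤ.* b) cleared p∤bd) p∣ad-cb)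
    where
    p∤bd : ¬ P ∣ b ℤ.* d
    p∤bd p∣bd = [ p∤b , p∤d ] (euclid b d p∣bd)
    cleared : (x - y) * toℚ (b ℤ.* d) ≡ toℚ (a ℤ.* d ℤ.- c ℤ.* b)
    cleared = begin
      (x - y) * toℚ (b ℤ.* d)
        ≡⟨ ≡.cong ((x - y) *_) (toℚ-homo-* b d) ⟩
      (x - y) * (toℚ b * toℚ d)
        ≡⟨ solve 4 (λ x y B D → (x :- y) :* (B :* D) := x :* B :* D :- y :* D :* B) refl x y (toℚ b) (toℚ d) ⟩
      x * toℚ b * toℚ d - y * toℚ d * toℚ b
        ≡⟨ cong₂ (λ u v → u * toℚ d - v * toℚ b) xb≡a yd≡c ⟩
      toℚ a * toℚ d - toℚ c * toℚ b
        ≡⟨ sym (cong₂ _-_ (toℚ-homo-* a d) (toℚ-homo-* c b)) ⟩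
      toℚ (a ℤ.* d) - toℚ (c ℤ.* b)
        ≡⟨ sym (toℚ-homo-- (a ℤ.* d) (c ℤ.* b)) ⟩
      toℚ (a ℤ.* d ℤ.- c ℤ.* b) ∎

strictlyIncreasing⇒injective : ∀ {n} (f : Fin n → ℕ) → (∀ i j → i Fin.< j → f i ℕ.< f j) → Injective _≡_ _≡_ f
strictlyIncreasing⇒injective f f-mono {i} {j} fᵢ≡fⱼ with <-cmp i j
... | tri< i<j _ _ = ⊥-elim (ℕP.<-irrefl fᵢ≡fⱼ (f-mono i j i<j))
... | tri≈ _ i≡j _ = i≡j
... | tri> _ _ j<i = ⊥-elim (ℕP.<-irrefl (≡.sym fᵢ≡fⱼ) (f-mono j i j<i))

open import Defs
open import Data.Nat using (ℕ; _+_; _*_; _∸_; _^_; _<_; _≤_; _/_)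
open import Data.Nat.Divisibility using (_∣_)
open import Data.Nat.Primality using (Prime)
open import Data.Integer using (+_; -_)
open import Data.Fin using (Fin) renaming (_<_ to _<ᶠ_)
open import Data.Product using (Σ)
open import Relation.Binary.PropositionalEquality using (_≡_)
open import Relation.Nullary using (¬_)
open import Data.Rational as ℚ using ()

theorem1p5 : (p k m : ℕ) → Prime p → ¬ (p ≡ 2) → 2 ≤ k → 2 ∣ k → p ≡ k * m + 1
    → ¬ KthPowerResidue k p (- (+ 1))
    → (α : Fin m → ℕ)
    → (∀ i → 0 < α i) → (∀ i → α i < p)
    → (∀ i j → i <ᶠ j → α i < α j)
    → (∀ i → KthPowerResidue k p (+ (α i)))
    → (∀ a → 0 < a → a < p → KthPowerResidue k p (+ a) → Σ (Fin m) (λ i → α i ≡ a))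
    → det m (λ i j → invℕ (α i + α j))
        ≡ℚ (signℚ ((m + 1) / 2) ℚ.* invℕ ((2 * k) ^ m)) [mod p ]
theorem1p5 p k zero p-prime _ _ _ p≡1 _ _ _ _ _ _ _ =
  ⊥-elim (¬prime[1] (≡.subst Prime (≡.trans p≡1 (≡.cong (_+ 1) (ℕP.*-zeroʳ k))) p-prime))
  where
  open import Data.Nat.Primality using (¬prime[1])
theorem1p5 p k (suc n) p-prime p≢2 2≤k _ p≡km+1 -1-nonresidue α α>0 α<p α-increasing α-residue α-complete =
  ≡ℚ[mod]-intro (det m (cauchyMatrix α)) (signℚ ((m + 1) / 2) ℚ.* invℕ ((2 * k) ^ m))
    (discriminant A) (pairSumProduct A) (ℤ.-1ℤ ℤ.^ ((m + 1) / 2)) (+ ((2 * k) ^ m))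
    (cauchy-det m α α>0)
    (signℚ*invℕ-cleared ((m + 1) / 2) ((2 * k) ^ m) (∤⇒>0 p∤[2k]ᵐ))
    p∤pairSumProduct p∤[2k]ᵐ (p∣x-y discriminant-congruence)
  where
  open PowerResidues p k n p-prime p≢2 (ℕP.<-≤-trans (ℕ.s≤s ℕ.z≤n) 2≤k) p≡km+1 -1-nonresidue
         α α<p (strictlyIncreasing⇒injective α α-increasing) α-residue α-complete
  open Congruence p p-prime using (p∣x-y; ∤⇒>0)
  open RationalCongruence p p-prime using (≡ℚ[mod]-intro)
  open Cauchy using (cauchy-det; cauchyMatrix; pairSumProduct)
  open Discriminant using (discriminant)
  open IntegerEmbedding using (signℚ*invℕ-cleared)
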